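{- Let $D$ be the formal derivative on $\mathbb Q[t,u,v]$ with respect to the grammar $\{t\rightarrow t^2v,\ u\rightarrow 2tuv,\ v\rightarrow 4tu\}$, i.e. the $\mathbb Q$-linear derivation with $D(t)=t^2v$, $D(u)=2tuv$, $D(v)=4tu$. Then for every $n\ge1$, $$D^n\!\left(\frac{v}{2}\right)=(n+1)!\,t^n\,M_{n-1}(u;v),$$ where $M_m(u;v)=\sum_{k=0}^{\lfloor m/2\rfloor}\binom{m}{2k}C_k u^{k+1}v^{m-2k}$ and $C_k=\frac{1}{k+1}\binom{2k}{k}$.
   Context: A formal derivative with respect to a grammar (a set of substitution rules $z\to f_z$ for variables $z$) is the linear operator $D$ satisfying $D(z)=f_z$, $D(uv)=D(u)v+uD(v)$ and $D(c)=0$ for constants. -}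

module Defs where

open import Data.Nat using (ℕ; zero; suc; _∸_; _≟_) renaming (_+_ to _+ℕ_; _*_ to _*ℕ_; _/_ to _/ℕ_)
open import Data.Nat.Combinatorics using (_C_)
open import Data.Integer using (+_)
open import Data.Rational using (ℚ; 0ℚ; 1ℚ; _+_; _*_; _/_)
open import Data.Bool using (Bool; true; false; _∧_; if_then_else_)
open import Relation.Nullary.Decidable using (⌊_⌋)
open import Relation.Binary.PropositionalEquality using (_≡_)

-- Formal polynomial expressions over ℚ in the variables t, u, v.
-- They denote elements of ℚ[t,u,v]; the denoted polynomial is given by `coeff`.
infixl 6 _⊕_
infixl 7 _⊗_
data Poly : Set where
  con : ℚ → Poly
  t u v : Poly
  _⊕_ _⊗_ : Poly → Poly → Poly

Σ≤ : ℕ → (ℕ → ℚ) → ℚ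
Σ≤ zero f = f 0
Σ≤ (suc n) f = Σ≤ n f + f (suc n)

isZ : ℕ → Bool
isZ zero = true
isZ (suc _) = false

isOne : ℕ → Bool
isOne n = ⌊ n ≟ 1 ⌋

coeff : Poly → ℕ → ℕ → ℕ → ℚ
coeff (con q) a b c = if isZ a ∧ isZ b ∧ isZ c then q else 0ℚ
coeff t a b c = if isOne a ∧ isZ b ∧ isZ c then 1ℚ else 0ℚ
coeff u a b c = if isZ a ∧ isOne b ∧ isZ c then 1ℚ else 0ℚ
coeff v a b c = if isZ a ∧ isZ b ∧ isOne c then 1ℚ else 0ℚ
coeff (p ⊕ q) a b c = coeff p a b c + coeff q a b c
coeff (p ⊗ q) a b c =
  Σ≤ a λ i → Σ≤ b λ j → Σ≤ c λ k → coeff p i j k * coeff q (a ∸ i) (b ∸ j) (c ∸ k)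

_≈P_ : Poly → Poly → Set
p ≈P q = ∀ a b c → coeff p a b c ≡ coeff q a b c


ℕ→ℚ : ℕ → ℚ
ℕ→ℚ n = + n / 1

D : Poly → Poly
D (con _) = con 0ℚ
D t = t ⊗ t ⊗ v
D u = con (ℕ→ℚ 2) ⊗ t ⊗ u ⊗ v
D v = con (ℕ→ℚ 4) ⊗ t ⊗ u
D (p ⊕ q) = D p ⊕ D q
D (p ⊗ q) = D p ⊗ q ⊕ p ⊗ D q

Dⁿ : ℕ → Poly → Poly
Dⁿ zero p = p
Dⁿ (suc n) p = D (Dⁿ n p)

pow : Poly → ℕ → Poly
pow p zero = con 1ℚ
pow p (suc n) = p ⊗ pow p n

ΣP : ℕ → (ℕ → Poly) → Poly
ΣP zero f = f 0
ΣP (suc n) f = ΣP n f ⊕ f (suc n)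

Catalan : ℕ → ℚ
Catalan k = + ((2 *ℕ k) C k) / suc k

M : ℕ → Poly
M m = ΣP (m /ℕ 2) λ k →
  con (ℕ→ℚ (m C (2 *ℕ k)) * Catalan k) ⊗ pow u (suc k) ⊗ pow v (m ∸ 2 *ℕ k)

module Submission where

-- The grammar acts on monomials by
--   D(t^a u^b v^c) = (a + 2b) t^(a+1) u^b v^(c+1) + 4c t^(a+1) u^(b+1) v^(c-1),
-- so on coefficient series D is a derivation of the Cauchy product built from multiplication by
-- t, u, v, the Euler operator t∂ₜ + 2u∂ᵤ and ∂ᵥ.  It raises the t-degree by exactly one, hence
-- Dⁿ(v/2) = tⁿ Hₙ(u, v), and for n = 2k + c the coefficient a(k, c) of u^(k+1) v^c in H_(n+1)
-- satisfies  a(k, c) = (n + 2k + 2) a(k, c-1) + 4(c + 1) a(k-1, c+1)  (terms with a negative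
-- index omitted).
-- The value (n+2)! n! / (k! (k+1)! c!) = (n+2)! binom(n, 2k) C_k solves this recurrence because
-- (n + 2) n = (n + 2k + 2) c + 4k(k + 1).

open import Defs
open import Algebra.Bundles using (CommutativeMonoid; CommutativeRing)
open import Data.Bool using (if_then_else_)
open import Data.Empty using (⊥-elim)
import Data.Integer as ℤ
import Data.Integer.Properties as ℤ
open import Data.Maybe using (nothing)
open import Data.Nat as ℕ using (ℕ; zero; suc; _≤_; z≤n; s≤s; _∸_; _!)
  renaming (_+_ to _+ℕ_; _*_ to _*ℕ_; _/_ to _/ℕ_)
open import Data.Nat.Combinatorics using (_C_; nCk≡n!/k![n-k]!; k![n∸k]!∣n!)
open import Data.Nat.DivMod using (m/n*n≡m; m*n/n≡m; m/n*n≤m; /-monoˡ-≤)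
import Data.Nat.Properties as ℕ
open import Data.Nat.Tactic.RingSolver using () renaming (solve-∀ to ℕ-solve-∀)
open import Data.Rational as ℚ using (ℚ; 0ℚ; 1ℚ; ½; _+_; _*_; toℚᵘ; Positive)
open import Data.Rational.Properties
open import Data.Rational.Unnormalised as ℚᵘ using (mkℚᵘ; *≡*)
import Data.Rational.Unnormalised.Properties as ℚᵘ
open import Function using (_∘_)
open import Level using (0ℓ)
open import Relation.Binary.Bundles using (Setoid)
open import Relation.Binary.PropositionalEquality
import Relation.Binary.Reasoning.Setoid as SetoidReasoning
open import Relation.Nullary using (Dec; does; yes; no)
open import Relation.Nullary.Decidable using (dec-true; dec-false)
import Tactic.RingSolver.Core.AlmostCommutativeRing as ACR
open import Tactic.RingSolver using (solve-∀)

open import Algebra.Properties.Semiring.Mult (CommutativeRing.semiring +-*-commutativeRing)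
  using (_×_; ×-homo-+; ×1-homo-*)
open import Algebra.Properties.CommutativeSemigroup
  (CommutativeMonoid.commutativeSemigroup +-0-commutativeMonoid)
  using () renaming (interchange to +-interchange)
open import Algebra.Properties.CommutativeSemigroup
  (CommutativeMonoid.commutativeSemigroup *-1-commutativeMonoid)
  using () renaming (x∙yz≈y∙xz to x*[y*z]≡y*[x*z])

ℚ-ring : ACR.AlmostCommutativeRing 0ℓ 0ℓ
ℚ-ring = ACR.fromCommutativeRing +-*-commutativeRing (λ _ → nothing)

*-zeroʳ² : ∀ x y → x * (y * 0ℚ) ≡ 0ℚ
*-zeroʳ² x y = trans (cong (x *_) (*-zeroʳ y)) (*-zeroʳ x)

ℕ→ℚ-suc : ∀ n → ℕ→ℚ (suc n) ≡ 1ℚ + ℕ→ℚ n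
ℕ→ℚ-suc n = toℚᵘ-injective (ℚᵘ.≃-trans (toℚᵘ-fromℚᵘ (mkℚᵘ (ℤ.+ suc n) 0))
  (ℚᵘ.≃-trans (*≡* numerators) (ℚᵘ.≃-sym (ℚᵘ.≃-trans (toℚᵘ-homo-+ 1ℚ (ℕ→ℚ n))
    (ℚᵘ.+-congʳ (toℚᵘ 1ℚ) (toℚᵘ-fromℚᵘ (mkℚᵘ (ℤ.+ n) 0)))))))
  where
  numerators : ℤ.+ suc n ℤ.* ℤ.+ 1 ≡ (ℤ.+ 1 ℤ.* ℤ.+ 1 ℤ.+ ℤ.+ n ℤ.* ℤ.+ 1) ℤ.* ℤ.+ 1
  numerators = trans (ℤ.*-identityʳ (ℤ.+ suc n))
    (sym (trans (ℤ.*-identityʳ _) (cong (ℤ._+_ (ℤ.+ 1)) (ℤ.*-identityʳ (ℤ.+ n)))))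

ℕ→ℚ≡×1 : ∀ n → ℕ→ℚ n ≡ n × 1ℚ
ℕ→ℚ≡×1 zero    = refl
ℕ→ℚ≡×1 (suc n) = trans (ℕ→ℚ-suc n) (cong (1ℚ +_) (ℕ→ℚ≡×1 n))

ℕ→ℚ-homo-+ : ∀ m n → ℕ→ℚ (m +ℕ n) ≡ ℕ→ℚ m + ℕ→ℚ n
ℕ→ℚ-homo-+ m n = begin
  ℕ→ℚ (m +ℕ n)     ≡⟨ ℕ→ℚ≡×1 (m +ℕ n) ⟩
  (m +ℕ n) × 1ℚ     ≡⟨ ×-homo-+ 1ℚ m n ⟩
  m × 1ℚ + n × 1ℚ   ≡⟨ cong₂ _+_ (ℕ→ℚ≡×1 m) (ℕ→ℚ≡×1 n) ⟨
  ℕ→ℚ m + ℕ→ℚ n     ∎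
  where open ≡-Reasoning

ℕ→ℚ-homo-* : ∀ m n → ℕ→ℚ (m *ℕ n) ≡ ℕ→ℚ m * ℕ→ℚ n
ℕ→ℚ-homo-* m n = begin
  ℕ→ℚ (m *ℕ n)     ≡⟨ ℕ→ℚ≡×1 (m *ℕ n) ⟩
  (m *ℕ n) × 1ℚ     ≡⟨ ×1-homo-* m n ⟩
  m × 1ℚ * n × 1ℚ   ≡⟨ cong₂ _*_ (ℕ→ℚ≡×1 m) (ℕ→ℚ≡×1 n) ⟨
  ℕ→ℚ m * ℕ→ℚ n     ∎
  where open ≡-Reasoning

ℕ→ℚ-lincomb : ∀ w x y z →
  ℕ→ℚ w * ℕ→ℚ x + ℕ→ℚ 4 * (ℕ→ℚ y * ℕ→ℚ z) ≡ ℕ→ℚ (w *ℕ x +ℕ 4 *ℕ (y *ℕ z))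
ℕ→ℚ-lincomb w x y z = sym (begin
  ℕ→ℚ (w *ℕ x +ℕ 4 *ℕ (y *ℕ z))
    ≡⟨ ℕ→ℚ-homo-+ (w *ℕ x) (4 *ℕ (y *ℕ z)) ⟩
  ℕ→ℚ (w *ℕ x) + ℕ→ℚ (4 *ℕ (y *ℕ z))
    ≡⟨ cong₂ _+_ (ℕ→ℚ-homo-* w x)
                 (trans (ℕ→ℚ-homo-* 4 (y *ℕ z)) (cong (ℕ→ℚ 4 *_) (ℕ→ℚ-homo-* y z))) ⟩
  ℕ→ℚ w * ℕ→ℚ x + ℕ→ℚ 4 * (ℕ→ℚ y * ℕ→ℚ z) ∎)
  where open ≡-Reasoning

ℕ→ℚ-suc-positive : ∀ n → Positive (ℕ→ℚ (suc n))
ℕ→ℚ-suc-positive n = normalize-pos (suc n) 1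

*-cancelʳ-ℕ→ℚ : ∀ n .{{_ : ℕ.NonZero n}} {x y} → x * ℕ→ℚ n ≡ y * ℕ→ℚ n → x ≡ y
*-cancelʳ-ℕ→ℚ (suc n) eq = ≤-antisym (cancel (≤-reflexive eq)) (cancel (≤-reflexive (sym eq)))
  where
  cancel : ∀ {p q} → p * ℕ→ℚ (suc n) ℚ.≤ q * ℕ→ℚ (suc n) → p ℚ.≤ q
  cancel {p} {q} = *-cancelʳ-≤-pos {p} {q} (ℕ→ℚ (suc n)) {{ℕ→ℚ-suc-positive n}}

Catalan-*-suc : ∀ k → Catalan k * ℕ→ℚ (suc k) ≡ ℕ→ℚ ((2 *ℕ k) C k)
Catalan-*-suc k = toℚᵘ-injective (ℚᵘ.≃-trans (toℚᵘ-homo-* (Catalan k) (ℕ→ℚ (suc k)))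
  (ℚᵘ.≃-trans (ℚᵘ.*-cong (toℚᵘ-fromℚᵘ (mkℚᵘ (ℤ.+ x) k)) (toℚᵘ-fromℚᵘ (mkℚᵘ (ℤ.+ suc k) 0)))
  (ℚᵘ.≃-trans (*≡* numerators) (ℚᵘ.≃-sym (toℚᵘ-fromℚᵘ (mkℚᵘ (ℤ.+ x) 0))))))
  where
  x : ℕ
  x = (2 *ℕ k) C k
  numerators : (ℤ.+ x ℤ.* ℤ.+ suc k) ℤ.* ℤ.+ 1 ≡ ℤ.+ x ℤ.* ℤ.+ (suc k *ℕ 1)
  numerators = trans (ℤ.*-identityʳ _) (cong (λ d → ℤ.+ x ℤ.* ℤ.+ d) (sym (ℕ.*-identityʳ (suc k))))

Σ≤-cong : ∀ n {f g : ℕ → ℚ} → (∀ i → i ≤ n → f i ≡ g i) → Σ≤ n f ≡ Σ≤ n g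
Σ≤-cong zero    eq = eq 0 z≤n
Σ≤-cong (suc n) eq =
  cong₂ _+_ (Σ≤-cong n (λ i i≤n → eq i (ℕ.m≤n⇒m≤1+n i≤n))) (eq (suc n) ℕ.≤-refl)

Σ≤-zero : ∀ n {f : ℕ → ℚ} → (∀ i → i ≤ n → f i ≡ 0ℚ) → Σ≤ n f ≡ 0ℚ
Σ≤-zero zero    eq = eq 0 z≤n
Σ≤-zero (suc n) eq = trans
  (cong₂ _+_ (Σ≤-zero n (λ i i≤n → eq i (ℕ.m≤n⇒m≤1+n i≤n))) (eq (suc n) ℕ.≤-refl))
  (+-identityˡ 0ℚ)

Σ≤-distrib-+ : ∀ n (f g : ℕ → ℚ) → Σ≤ n (λ i → f i + g i) ≡ Σ≤ n f + Σ≤ n g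
Σ≤-distrib-+ zero    f g = refl
Σ≤-distrib-+ (suc n) f g = trans (cong (_+ (f (suc n) + g (suc n))) (Σ≤-distrib-+ n f g))
                                 (+-interchange (Σ≤ n f) (Σ≤ n g) (f (suc n)) (g (suc n)))

*-distribˡ-Σ≤ : ∀ n q (f : ℕ → ℚ) → q * Σ≤ n f ≡ Σ≤ n (λ i → q * f i)
*-distribˡ-Σ≤ zero    q f = refl
*-distribˡ-Σ≤ (suc n) q f =
  trans (*-distribˡ-+ q (Σ≤ n f) (f (suc n))) (cong (_+ q * f (suc n)) (*-distribˡ-Σ≤ n q f))

Σ≤-head : ∀ n (f : ℕ → ℚ) → Σ≤ (suc n) f ≡ f 0 + Σ≤ n (λ i → f (suc i))
Σ≤-head zero    f = refl
Σ≤-head (suc n) f = trans (cong (_+ f (suc (suc n))) (Σ≤-head n f)) (+-assoc (f 0) _ _)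

Σ≤-single : ∀ n k (f : ℕ → ℚ) → k ≤ n → (∀ i → i ≢ k → f i ≡ 0ℚ) → Σ≤ n f ≡ f k
Σ≤-single zero    .zero f z≤n vanish = refl
Σ≤-single (suc n) k     f k≤  vanish with k ℕ.≟ suc n
... | yes refl = trans (cong (_+ f (suc n)) (Σ≤-zero n λ i i≤n → vanish i (ℕ.<⇒≢ (s≤s i≤n))))
                       (+-identityˡ (f (suc n)))
... | no  k≢   = trans (cong (Σ≤ n f +_) (vanish (suc n) (≢-sym k≢)))
  (trans (+-identityʳ (Σ≤ n f)) (Σ≤-single n k f (ℕ.≤-pred (ℕ.≤∧≢⇒< k≤ k≢)) vanish))

Σ≤-first : ∀ n (f : ℕ → ℚ) → (∀ i → f (suc i) ≡ 0ℚ) → Σ≤ n f ≡ f 0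
Σ≤-first n f vanish = Σ≤-single n 0 f z≤n λ where
  zero    0≢0 → ⊥-elim (0≢0 refl)
  (suc i) _   → vanish i

Σ≤-shiftˡ : ∀ a (T : ℕ → ℕ → ℚ) → (∀ m → T 0 m ≡ 0ℚ) →
            Σ≤ (suc a) (λ i → T i (suc a ∸ i)) ≡ Σ≤ a (λ i → T (suc i) (a ∸ i))
Σ≤-shiftˡ a T vanish = trans (Σ≤-head a (λ i → T i (suc a ∸ i)))
  (trans (cong (_+ Σ≤ a (λ i → T (suc i) (a ∸ i))) (vanish (suc a))) (+-identityˡ _))

Σ≤-shiftʳ : ∀ a (T : ℕ → ℕ → ℚ) → (∀ i → T i 0 ≡ 0ℚ) →
            Σ≤ (suc a) (λ i → T i (suc a ∸ i)) ≡ Σ≤ a (λ i → T i (suc (a ∸ i)))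
Σ≤-shiftʳ a T vanish = trans
  (cong (Σ≤ a (λ i → T i (suc a ∸ i)) +_) (trans (cong (T (suc a)) (ℕ.n∸n≡0 a)) (vanish (suc a))))
  (trans (+-identityʳ _) (Σ≤-cong a λ i i≤a → cong (T i) (ℕ.+-∸-assoc 1 i≤a)))

Σ≤-leibniz : ∀ c (h l : ℕ → ℚ) →
  ℕ→ℚ (suc c) * Σ≤ (suc c) (λ k → h k * l (suc c ∸ k)) ≡
  Σ≤ c (λ k → (ℕ→ℚ (suc k) * h (suc k)) * l (c ∸ k)) +
  Σ≤ c (λ k → h k * (ℕ→ℚ (suc (c ∸ k)) * l (suc (c ∸ k))))
Σ≤-leibniz c h l = begin
  ℕ→ℚ (suc c) * Σ≤ (suc c) (λ k → h k * l (suc c ∸ k))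
    ≡⟨ *-distribˡ-Σ≤ (suc c) (ℕ→ℚ (suc c)) _ ⟩
  Σ≤ (suc c) (λ k → ℕ→ℚ (suc c) * (h k * l (suc c ∸ k)))
    ≡⟨ Σ≤-cong (suc c) (λ k k≤ → split k≤) ⟩
  Σ≤ (suc c) (λ k → ℕ→ℚ k * (h k * l (suc c ∸ k)) + ℕ→ℚ (suc c ∸ k) * (h k * l (suc c ∸ k)))
    ≡⟨ Σ≤-distrib-+ (suc c) _ _ ⟩
  Σ≤ (suc c) (λ k → ℕ→ℚ k * (h k * l (suc c ∸ k))) +
  Σ≤ (suc c) (λ k → ℕ→ℚ (suc c ∸ k) * (h k * l (suc c ∸ k)))
    ≡⟨ cong₂ _+_ (Σ≤-shiftˡ c (λ k m → ℕ→ℚ k * (h k * l m)) (λ m → *-zeroˡ (h 0 * l m)))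
                 (Σ≤-shiftʳ c (λ k m → ℕ→ℚ m * (h k * l m)) (λ k → *-zeroˡ (h k * l 0))) ⟩
  Σ≤ c (λ k → ℕ→ℚ (suc k) * (h (suc k) * l (c ∸ k))) +
  Σ≤ c (λ k → ℕ→ℚ (suc (c ∸ k)) * (h k * l (suc (c ∸ k))))
    ≡⟨ cong₂ _+_ (Σ≤-cong c λ k _ → sym (*-assoc (ℕ→ℚ (suc k)) (h (suc k)) (l (c ∸ k))))
                 (Σ≤-cong c λ k _ → x*[y*z]≡y*[x*z] (ℕ→ℚ (suc (c ∸ k))) (h k) (l (suc (c ∸ k)))) ⟩
  Σ≤ c (λ k → (ℕ→ℚ (suc k) * h (suc k)) * l (c ∸ k)) +
  Σ≤ c (λ k → h k * (ℕ→ℚ (suc (c ∸ k)) * l (suc (c ∸ k)))) ∎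
  where
  open ≡-Reasoning
  split : ∀ {k} → k ≤ suc c → ℕ→ℚ (suc c) * (h k * l (suc c ∸ k)) ≡
          ℕ→ℚ k * (h k * l (suc c ∸ k)) + ℕ→ℚ (suc c ∸ k) * (h k * l (suc c ∸ k))
  split {k} k≤ = trans (cong (λ n → ℕ→ℚ n * (h k * l (suc c ∸ k))) (sym (ℕ.m+[n∸m]≡n k≤)))
    (trans (cong (_* (h k * l (suc c ∸ k))) (ℕ→ℚ-homo-+ k (suc c ∸ k)))
           (*-distribʳ-+ (h k * l (suc c ∸ k)) (ℕ→ℚ k) (ℕ→ℚ (suc c ∸ k))))

-- Coefficient series and the Cauchy product

Series : Set
Series = ℕ → ℕ → ℕ → ℚ

infix 4 _≐_
record _≐_ (f g : Series) : Set where
  constructor pointwise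
  field at : ∀ a b c → f a b c ≡ g a b c
open _≐_ public

≐-refl : ∀ {f} → f ≐ f
≐-refl = pointwise λ _ _ _ → refl

≐-sym : ∀ {f g} → f ≐ g → g ≐ f
≐-sym f≐g = pointwise λ a b c → sym (at f≐g a b c)

≐-trans : ∀ {f g h} → f ≐ g → g ≐ h → f ≐ h
≐-trans f≐g g≐h = pointwise λ a b c → trans (at f≐g a b c) (at g≐h a b c)

≐-setoid : Setoid 0ℓ 0ℓ
≐-setoid = record
  { Carrier       = Series
  ; _≈_           = _≐_
  ; isEquivalence = record { refl = ≐-refl ; sym = ≐-sym ; trans = ≐-trans }
  }

module ≐-Reasoning = SetoidReasoning ≐-setoid

infixl 6 _+ˢ_
infixl 7 _*ˢ_
infixr 8 _·ˢ_ t·_ u·_ v·_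

_+ˢ_ : Series → Series → Series
(f +ˢ g) a b c = f a b c + g a b c

_·ˢ_ : ℚ → Series → Series
(q ·ˢ f) a b c = q * f a b c

Σ³ : ℕ → ℕ → ℕ → (ℕ → ℕ → ℕ → ℚ) → ℚ
Σ³ a b c φ = Σ≤ a λ i → Σ≤ b λ j → Σ≤ c λ k → φ i j k

_*ˢ_ : Series → Series → Series
(f *ˢ g) a b c = Σ³ a b c λ i j k → f i j k * g (a ∸ i) (b ∸ j) (c ∸ k)

1ˢ : Series
1ˢ zero zero zero = 1ℚ
1ˢ _    _    _    = 0ℚ

t·_ u·_ v·_ : Series → Series
(t· f) zero    b c = 0ℚ
(t· f) (suc a) b c = f a b c
(u· f) a zero    c = 0ℚ
(u· f) a (suc b) c = f a b c
(v· f) a b zero    = 0ℚ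
(v· f) a b (suc c) = f a b c

+ˢ-cong : ∀ {f f′ g g′} → f ≐ f′ → g ≐ g′ → f +ˢ g ≐ f′ +ˢ g′
+ˢ-cong f≐ g≐ = pointwise λ a b c → cong₂ _+_ (at f≐ a b c) (at g≐ a b c)

+ˢ-interchange : ∀ f g h k → (f +ˢ g) +ˢ (h +ˢ k) ≐ (f +ˢ h) +ˢ (g +ˢ k)
+ˢ-interchange f g h k = pointwise λ a b c → +-interchange (f a b c) (g a b c) (h a b c) (k a b c)

Σ³-cong : ∀ a b c {φ ψ : ℕ → ℕ → ℕ → ℚ} →
          (∀ i j k → i ≤ a → j ≤ b → k ≤ c → φ i j k ≡ ψ i j k) → Σ³ a b c φ ≡ Σ³ a b c ψ
Σ³-cong a b c eq =
  Σ≤-cong a λ i i≤a → Σ≤-cong b λ j j≤b → Σ≤-cong c λ k k≤c → eq i j k i≤a j≤b k≤c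

Σ³-distrib-+ : ∀ a b c (φ ψ : ℕ → ℕ → ℕ → ℚ) →
               Σ³ a b c (λ i j k → φ i j k + ψ i j k) ≡ Σ³ a b c φ + Σ³ a b c ψ
Σ³-distrib-+ a b c φ ψ = trans
  (Σ≤-cong a λ i _ → trans (Σ≤-cong b λ j _ → Σ≤-distrib-+ c _ _) (Σ≤-distrib-+ b _ _))
  (Σ≤-distrib-+ a _ _)

*-distribˡ-Σ³ : ∀ a b c q (φ : ℕ → ℕ → ℕ → ℚ) → q * Σ³ a b c φ ≡ Σ³ a b c (λ i j k → q * φ i j k)
*-distribˡ-Σ³ a b c q φ = trans (*-distribˡ-Σ≤ a q _)
  (Σ≤-cong a λ i _ → trans (*-distribˡ-Σ≤ b q _) (Σ≤-cong b λ j _ → *-distribˡ-Σ≤ c q _))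

*ˢ-cong : ∀ {f f′ g g′} → f ≐ f′ → g ≐ g′ → f *ˢ g ≐ f′ *ˢ g′
*ˢ-cong f≐ g≐ = pointwise λ a b c → Σ³-cong a b c λ i j k _ _ _ →
  cong₂ _*_ (at f≐ i j k) (at g≐ (a ∸ i) (b ∸ j) (c ∸ k))

*ˢ-congˡ : ∀ {f f′} g → f ≐ f′ → f *ˢ g ≐ f′ *ˢ g
*ˢ-congˡ g f≐ = *ˢ-cong f≐ (≐-refl {g})

*ˢ-congʳ : ∀ f {g g′} → g ≐ g′ → f *ˢ g ≐ f *ˢ g′
*ˢ-congʳ f g≐ = *ˢ-cong (≐-refl {f}) g≐

*ˢ-distribʳ-+ˢ : ∀ f g h → (f +ˢ g) *ˢ h ≐ f *ˢ h +ˢ g *ˢ h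
*ˢ-distribʳ-+ˢ f g h = pointwise λ a b c → trans
  (Σ³-cong a b c λ i j k _ _ _ → *-distribʳ-+ (h (a ∸ i) (b ∸ j) (c ∸ k)) (f i j k) (g i j k))
  (Σ³-distrib-+ a b c _ _)

*ˢ-distribˡ-+ˢ : ∀ f g h → h *ˢ (f +ˢ g) ≐ h *ˢ f +ˢ h *ˢ g
*ˢ-distribˡ-+ˢ f g h = pointwise λ a b c → trans
  (Σ³-cong a b c λ i j k _ _ _ → *-distribˡ-+ (h i j k) (f (a ∸ i) (b ∸ j) (c ∸ k)) _)
  (Σ³-distrib-+ a b c _ _)

*ˢ-identityˡ : ∀ g → 1ˢ *ˢ g ≐ g
*ˢ-identityˡ g = pointwise λ a b c → begin
  (1ˢ *ˢ g) a b c
    ≡⟨ Σ≤-first a _ (λ i → Σ≤-zero b λ j _ → Σ≤-zero c λ k _ →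
                             *-zeroˡ (g (a ∸ suc i) (b ∸ j) (c ∸ k))) ⟩
  (Σ≤ b λ j → Σ≤ c λ k → 1ˢ 0 j k * g a (b ∸ j) (c ∸ k))
    ≡⟨ Σ≤-first b _ (λ j → Σ≤-zero c λ k _ → *-zeroˡ (g a (b ∸ suc j) (c ∸ k))) ⟩
  (Σ≤ c λ k → 1ˢ 0 0 k * g a b (c ∸ k))
    ≡⟨ Σ≤-first c _ (λ k → *-zeroˡ (g a b (c ∸ suc k))) ⟩
  1ℚ * g a b c
    ≡⟨ *-identityˡ (g a b c) ⟩
  g a b c ∎
  where open ≡-Reasoning

-- Centralizers and derivations of the Cauchy product

record IsLinear (L : Series → Series) : Set where
  field
    ≐-cong : ∀ {f g} → f ≐ g → L f ≐ L g
    +-homo : ∀ f g → L (f +ˢ g) ≐ L f +ˢ L g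

record IsCentralizer (S : Series → Series) : Set where
  field
    isLinear : IsLinear S
    left     : ∀ f g → S (f *ˢ g) ≐ S f *ˢ g
    right    : ∀ f g → S (f *ˢ g) ≐ f *ˢ S g
  open IsLinear isLinear public

record IsDerivation (d : Series → Series) : Set where
  field
    isLinear : IsLinear d
    leibniz  : ∀ f g → d (f *ˢ g) ≐ d f *ˢ g +ˢ f *ˢ d g
  open IsLinear isLinear public

·ˢ-isCentralizer : ∀ q → IsCentralizer (q ·ˢ_)
·ˢ-isCentralizer q = record
  { isLinear = record
    { ≐-cong = λ f≐g → pointwise λ a b c → cong (q *_) (at f≐g a b c)
    ; +-homo = λ f g → pointwise λ a b c → *-distribˡ-+ q (f a b c) (g a b c)
    }
  ; left     = λ f g → pointwise λ a b c → trans (*-distribˡ-Σ³ a b c q _)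
      (Σ³-cong a b c λ i j k _ _ _ → sym (*-assoc q (f i j k) _))
  ; right    = λ f g → pointwise λ a b c → trans (*-distribˡ-Σ³ a b c q _)
      (Σ³-cong a b c λ i j k _ _ _ → x*[y*z]≡y*[x*z] q (f i j k) _)
  }

t·-isCentralizer : IsCentralizer t·_
t·-isCentralizer = record
  { isLinear = record
    { ≐-cong = λ f≐g → pointwise λ where
        zero    b c → refl
        (suc a) b c → at f≐g a b c
    ; +-homo = λ f g → pointwise λ where
        zero    b c → sym (+-identityʳ 0ℚ)
        (suc a) b c → refl
    }
  ; left     = λ f g → pointwise λ where
      zero    b c → sym (Σ≤-zero b λ j _ → Σ≤-zero c λ k _ → *-zeroˡ (g 0 (b ∸ j) (c ∸ k)))
      (suc a) b c → sym (Σ≤-shiftˡ a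
        (λ i m → Σ≤ b λ j → Σ≤ c λ k → (t· f) i j k * g m (b ∸ j) (c ∸ k))
        (λ m → Σ≤-zero b λ j _ → Σ≤-zero c λ k _ → *-zeroˡ (g m (b ∸ j) (c ∸ k))))
  ; right    = λ f g → pointwise λ where
      zero    b c → sym (Σ≤-zero b λ j _ → Σ≤-zero c λ k _ → *-zeroʳ (f 0 j k))
      (suc a) b c → sym (Σ≤-shiftʳ a
        (λ i m → Σ≤ b λ j → Σ≤ c λ k → f i j k * (t· g) m (b ∸ j) (c ∸ k))
        (λ i → Σ≤-zero b λ j _ → Σ≤-zero c λ k _ → *-zeroʳ (f i j k)))
  }

u·-isCentralizer : IsCentralizer u·_
u·-isCentralizer = record
  { isLinear = record
    { ≐-cong = λ f≐g → pointwise λ where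
        a zero    c → refl
        a (suc b) c → at f≐g a b c
    ; +-homo = λ f g → pointwise λ where
        a zero    c → sym (+-identityʳ 0ℚ)
        a (suc b) c → refl
    }
  ; left     = λ f g → pointwise λ where
      a zero    c → sym (Σ≤-zero a λ i _ → Σ≤-zero c λ k _ → *-zeroˡ (g (a ∸ i) 0 (c ∸ k)))
      a (suc b) c → sym (Σ≤-cong a λ i _ → Σ≤-shiftˡ b
        (λ j m → Σ≤ c λ k → (u· f) i j k * g (a ∸ i) m (c ∸ k))
        (λ m → Σ≤-zero c λ k _ → *-zeroˡ (g (a ∸ i) m (c ∸ k))))
  ; right    = λ f g → pointwise λ where
      a zero    c → sym (Σ≤-zero a λ i _ → Σ≤-zero c λ k _ → *-zeroʳ (f i 0 k))
      a (suc b) c → sym (Σ≤-cong a λ i _ → Σ≤-shiftʳ b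
        (λ j m → Σ≤ c λ k → f i j k * (u· g) (a ∸ i) m (c ∸ k))
        (λ j → Σ≤-zero c λ k _ → *-zeroʳ (f i j k)))
  }

v·-isCentralizer : IsCentralizer v·_
v·-isCentralizer = record
  { isLinear = record
    { ≐-cong = λ f≐g → pointwise λ where
        a b zero    → refl
        a b (suc c) → at f≐g a b c
    ; +-homo = λ f g → pointwise λ where
        a b zero    → sym (+-identityʳ 0ℚ)
        a b (suc c) → refl
    }
  ; left     = λ f g → pointwise λ where
      a b zero    → sym (Σ≤-zero a λ i _ → Σ≤-zero b λ j _ → *-zeroˡ (g (a ∸ i) (b ∸ j) 0))
      a b (suc c) → sym (Σ≤-cong a λ i _ → Σ≤-cong b λ j _ → Σ≤-shiftˡ c
        (λ k m → (v· f) i j k * g (a ∸ i) (b ∸ j) m)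
        (λ m → *-zeroˡ (g (a ∸ i) (b ∸ j) m)))
  ; right    = λ f g → pointwise λ where
      a b zero    → sym (Σ≤-zero a λ i _ → Σ≤-zero b λ j _ → *-zeroʳ (f i j 0))
      a b (suc c) → sym (Σ≤-cong a λ i _ → Σ≤-cong b λ j _ → Σ≤-shiftʳ c
        (λ k m → f i j k * (v· g) (a ∸ i) (b ∸ j) m)
        (λ k → *-zeroʳ (f i j k)))
  }

∘-isCentralizer : ∀ {S S′} → IsCentralizer S → IsCentralizer S′ → IsCentralizer (λ f → S (S′ f))
∘-isCentralizer {S} {S′} S-central S′-central = record
  { isLinear = record
    { ≐-cong = λ f≐g → S.≐-cong (S′.≐-cong f≐g)
    ; +-homo = λ f g → ≐-trans (S.≐-cong (S′.+-homo f g)) (S.+-homo (S′ f) (S′ g))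
    }
  ; left     = λ f g → ≐-trans (S.≐-cong (S′.left f g)) (S.left (S′ f) g)
  ; right    = λ f g → ≐-trans (S.≐-cong (S′.right f g)) (S.right f (S′ g))
  }
  where
  module S  = IsCentralizer S-central
  module S′ = IsCentralizer S′-central

infixr 9 _^_
_^_ : (Series → Series) → ℕ → Series → Series
(S ^ zero)  f = f
(S ^ suc n) f = S ((S ^ n) f)

^-isCentralizer : ∀ {S} → IsCentralizer S → ∀ n → IsCentralizer (S ^ n)
^-isCentralizer S-central zero    = record
  { isLinear = record { ≐-cong = λ f≐g → f≐g ; +-homo = λ _ _ → ≐-refl }
  ; left     = λ _ _ → ≐-refl
  ; right    = λ _ _ → ≐-refl
  }
^-isCentralizer S-central (suc n) = ∘-isCentralizer S-central (^-isCentralizer S-central n)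

centralizer-*ˢ : ∀ {S} → IsCentralizer S → ∀ g → S 1ˢ *ˢ g ≐ S g
centralizer-*ˢ S-central g = ≐-trans (≐-sym (IsCentralizer.left S-central 1ˢ g))
                                     (IsCentralizer.≐-cong S-central (*ˢ-identityˡ g))

∘-isDerivation : ∀ {S d} → IsCentralizer S → IsDerivation d → IsDerivation (λ f → S (d f))
∘-isDerivation {S} {d} S-central d-derivation = record
  { isLinear = record
    { ≐-cong = λ f≐g → S.≐-cong (d.≐-cong f≐g)
    ; +-homo = λ f g → ≐-trans (S.≐-cong (d.+-homo f g)) (S.+-homo (d f) (d g))
    }
  ; leibniz  = λ f g → begin
      S (d (f *ˢ g))                ≈⟨ S.≐-cong (d.leibniz f g) ⟩
      S (d f *ˢ g +ˢ f *ˢ d g)      ≈⟨ S.+-homo (d f *ˢ g) (f *ˢ d g) ⟩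
      S (d f *ˢ g) +ˢ S (f *ˢ d g)  ≈⟨ +ˢ-cong (S.left (d f) g) (S.right f (d g)) ⟩
      S (d f) *ˢ g +ˢ f *ˢ S (d g)  ∎
  }
  where
  module S = IsCentralizer S-central
  module d = IsDerivation d-derivation
  open ≐-Reasoning

+ˢ-isDerivation : ∀ {d e} → IsDerivation d → IsDerivation e → IsDerivation (λ f → d f +ˢ e f)
+ˢ-isDerivation {d} {e} d-derivation e-derivation = record
  { isLinear = record
    { ≐-cong = λ f≐g → +ˢ-cong (d.≐-cong f≐g) (e.≐-cong f≐g)
    ; +-homo = λ f g → ≐-trans (+ˢ-cong (d.+-homo f g) (e.+-homo f g))
                               (+ˢ-interchange (d f) (d g) (e f) (e g))
    }
  ; leibniz  = λ f g → begin
      d (f *ˢ g) +ˢ e (f *ˢ g)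
        ≈⟨ +ˢ-cong (d.leibniz f g) (e.leibniz f g) ⟩
      (d f *ˢ g +ˢ f *ˢ d g) +ˢ (e f *ˢ g +ˢ f *ˢ e g)
        ≈⟨ +ˢ-interchange (d f *ˢ g) (f *ˢ d g) (e f *ˢ g) (f *ˢ e g) ⟩
      (d f *ˢ g +ˢ e f *ˢ g) +ˢ (f *ˢ d g +ˢ f *ˢ e g)
        ≈⟨ +ˢ-cong (*ˢ-distribʳ-+ˢ (d f) (e f) g) (*ˢ-distribˡ-+ˢ (d g) (e g) f) ⟨
      (d f +ˢ e f) *ˢ g +ˢ f *ˢ (d g +ˢ e g) ∎
  }
  where
  module d = IsDerivation d-derivation
  module e = IsDerivation e-derivation
  open ≐-Reasoning

Additive : (ℕ → ℕ → ℕ → ℕ) → Set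
Additive w = ∀ a b c a′ b′ c′ → w (a +ℕ a′) (b +ℕ b′) (c +ℕ c′) ≡ w a b c +ℕ w a′ b′ c′

euler : (ℕ → ℕ → ℕ → ℕ) → Series → Series
euler w f a b c = ℕ→ℚ (w a b c) * f a b c

euler-isDerivation : ∀ {w} → Additive w → IsDerivation (euler w)
euler-isDerivation {w} additive = record
  { isLinear = record
    { ≐-cong = λ f≐g → pointwise λ a b c → cong (ℕ→ℚ (w a b c) *_) (at f≐g a b c)
    ; +-homo = λ f g → pointwise λ a b c → *-distribˡ-+ (ℕ→ℚ (w a b c)) (f a b c) (g a b c)
    }
  ; leibniz  = λ f g → pointwise λ a b c → trans (*-distribˡ-Σ³ a b c (ℕ→ℚ (w a b c)) _)
      (trans (Σ³-cong a b c λ i j k → split f g) (Σ³-distrib-+ a b c _ _))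
  }
  where
  open ≡-Reasoning
  weight-split : ∀ {a b c i j k} → i ≤ a → j ≤ b → k ≤ c →
                 w a b c ≡ w i j k +ℕ w (a ∸ i) (b ∸ j) (c ∸ k)
  weight-split {a} {b} {c} {i} {j} {k} i≤a j≤b k≤c = begin
    w a b c
      ≡⟨ cong₂ (λ x y → w x y c) (ℕ.m+[n∸m]≡n i≤a) (ℕ.m+[n∸m]≡n j≤b) ⟨
    w (i +ℕ (a ∸ i)) (j +ℕ (b ∸ j)) c
      ≡⟨ cong (w (i +ℕ (a ∸ i)) (j +ℕ (b ∸ j))) (ℕ.m+[n∸m]≡n k≤c) ⟨
    w (i +ℕ (a ∸ i)) (j +ℕ (b ∸ j)) (k +ℕ (c ∸ k))
      ≡⟨ additive i j k (a ∸ i) (b ∸ j) (c ∸ k) ⟩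
    w i j k +ℕ w (a ∸ i) (b ∸ j) (c ∸ k) ∎
  distrib : ∀ x y p q → (x + y) * (p * q) ≡ (x * p) * q + p * (y * q)
  distrib = solve-∀ ℚ-ring
  split : ∀ f g {a b c i j k} → i ≤ a → j ≤ b → k ≤ c →
    ℕ→ℚ (w a b c) * (f i j k * g (a ∸ i) (b ∸ j) (c ∸ k)) ≡
    euler w f i j k * g (a ∸ i) (b ∸ j) (c ∸ k) + f i j k * euler w g (a ∸ i) (b ∸ j) (c ∸ k)
  split f g {a} {b} {c} {i} {j} {k} i≤a j≤b k≤c = begin
    ℕ→ℚ (w a b c) * (f i j k * g′)
      ≡⟨ cong (λ x → ℕ→ℚ x * (f i j k * g′)) (weight-split i≤a j≤b k≤c) ⟩
    ℕ→ℚ (w i j k +ℕ w′) * (f i j k * g′)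
      ≡⟨ cong (_* (f i j k * g′)) (ℕ→ℚ-homo-+ (w i j k) w′) ⟩
    (ℕ→ℚ (w i j k) + ℕ→ℚ w′) * (f i j k * g′)
      ≡⟨ distrib (ℕ→ℚ (w i j k)) (ℕ→ℚ w′) (f i j k) g′ ⟩
    euler w f i j k * g′ + f i j k * (ℕ→ℚ w′ * g′) ∎
    where
    w′ : ℕ
    w′ = w (a ∸ i) (b ∸ j) (c ∸ k)
    g′ : ℚ
    g′ = g (a ∸ i) (b ∸ j) (c ∸ k)

∂ᵥ : Series → Series
∂ᵥ f a b c = ℕ→ℚ (suc c) * f a b (suc c)

∂ᵥ-isDerivation : IsDerivation ∂ᵥ
∂ᵥ-isDerivation = record
  { isLinear = record
    { ≐-cong = λ f≐g → pointwise λ a b c → cong (ℕ→ℚ (suc c) *_) (at f≐g a b (suc c))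
    ; +-homo = λ f g → pointwise λ a b c →
        *-distribˡ-+ (ℕ→ℚ (suc c)) (f a b (suc c)) (g a b (suc c))
    }
  ; leibniz  = λ f g → pointwise λ a b c → begin
      ℕ→ℚ (suc c) * (f *ˢ g) a b (suc c)
        ≡⟨ *-distribˡ-Σ≤ a (ℕ→ℚ (suc c)) _ ⟩
      (Σ≤ a λ i → ℕ→ℚ (suc c) *
        Σ≤ b λ j → Σ≤ (suc c) λ k → f i j k * g (a ∸ i) (b ∸ j) (suc c ∸ k))
        ≡⟨ Σ≤-cong a (λ i _ → *-distribˡ-Σ≤ b (ℕ→ℚ (suc c)) _) ⟩
      (Σ≤ a λ i → Σ≤ b λ j → ℕ→ℚ (suc c) *
        Σ≤ (suc c) λ k → f i j k * g (a ∸ i) (b ∸ j) (suc c ∸ k))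
        ≡⟨ Σ≤-cong a (λ i _ → Σ≤-cong b λ j _ → Σ≤-leibniz c (f i j) (g (a ∸ i) (b ∸ j))) ⟩
      (Σ≤ a λ i → Σ≤ b λ j → Σ≤ c (λ k → ∂ᵥ f i j k * g (a ∸ i) (b ∸ j) (c ∸ k)) +
                             Σ≤ c (λ k → f i j k * ∂ᵥ g (a ∸ i) (b ∸ j) (c ∸ k)))
        ≡⟨ trans (Σ≤-cong a λ i _ → Σ≤-distrib-+ b _ _) (Σ≤-distrib-+ a _ _) ⟩
      (∂ᵥ f *ˢ g +ˢ f *ˢ ∂ᵥ g) a b c ∎
  }
  where open ≡-Reasoning

-- The grammar derivation on coefficient series

θ-weight : ℕ → ℕ → ℕ → ℕ
θ-weight a b _ = a +ℕ 2 *ℕ b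

θ-weight-additive : Additive θ-weight
θ-weight-additive a b _ a′ b′ _ = expand a b a′ b′
  where
  expand : ∀ a b a′ b′ → a +ℕ a′ +ℕ 2 *ℕ (b +ℕ b′) ≡ a +ℕ 2 *ℕ b +ℕ (a′ +ℕ 2 *ℕ b′)
  expand = ℕ-solve-∀

θ : Series → Series
θ = euler θ-weight

-- D = t (v θ + 4u ∂ᵥ), where θ = t∂ₜ + 2u∂ᵤ multiplies t^a u^b v^c by a + 2b.
δ : Series → Series
δ f = t· (v· θ f +ˢ u· ℕ→ℚ 4 ·ˢ ∂ᵥ f)

δ-isDerivation : IsDerivation δ
δ-isDerivation = ∘-isDerivation t·-isCentralizer (+ˢ-isDerivation
  (∘-isDerivation v·-isCentralizer (euler-isDerivation {θ-weight} θ-weight-additive))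
  (∘-isDerivation u·-isCentralizer (∘-isDerivation (·ˢ-isCentralizer (ℕ→ℚ 4)) ∂ᵥ-isDerivation)))

coeff-con : ∀ q → coeff (con q) ≐ q ·ˢ 1ˢ
coeff-con q = pointwise λ where
  zero    zero    zero    → sym (*-identityʳ q)
  zero    zero    (suc c) → sym (*-zeroʳ q)
  zero    (suc b) c       → sym (*-zeroʳ q)
  (suc a) b       c       → sym (*-zeroʳ q)

coeff-t : coeff t ≐ t· 1ˢ
coeff-t = pointwise λ where
  zero          b       c       → refl
  (suc zero)    zero    zero    → refl
  (suc zero)    zero    (suc c) → refl
  (suc zero)    (suc b) c       → refl
  (suc (suc a)) b       c       → refl

coeff-u : coeff u ≐ u· 1ˢ
coeff-u = pointwise λ where
  zero    zero          c       → refl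
  (suc a) zero          c       → refl
  zero    (suc zero)    zero    → refl
  zero    (suc zero)    (suc c) → refl
  zero    (suc (suc b)) c       → refl
  (suc a) (suc b)       c       → refl

coeff-v : coeff v ≐ v· 1ˢ
coeff-v = pointwise λ where
  zero    zero    zero          → refl
  zero    zero    (suc zero)    → refl
  zero    zero    (suc (suc c)) → refl
  zero    (suc b) zero          → refl
  zero    (suc b) (suc c)       → refl
  (suc a) b       zero          → refl
  (suc a) b       (suc c)       → refl

δ-const : ∀ q → δ (q ·ˢ 1ˢ) ≐ 0ℚ ·ˢ 1ˢ
δ-const q = pointwise λ where
    zero    b c → sym (*-zeroˡ (1ˢ 0 b c))
    (suc a) b c → trans (cong₂ _+_ (θ-part a b c) (∂ᵥ-part a b c))
                        (trans (+-identityʳ 0ℚ) (sym (*-zeroˡ (1ˢ (suc a) b c))))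
  where
  θ-part : ∀ a b c → (v· θ (q ·ˢ 1ˢ)) a b c ≡ 0ℚ
  θ-part a       b       zero    = refl
  θ-part zero    zero    (suc c) = *-zeroˡ (q * 1ˢ 0 0 c)
  θ-part zero    (suc b) (suc c) = *-zeroʳ² (ℕ→ℚ (2 *ℕ suc b)) q
  θ-part (suc a) b       (suc c) = *-zeroʳ² (ℕ→ℚ (suc a +ℕ 2 *ℕ b)) q
  4*[x*[q*0]]≡0 : ∀ x → ℕ→ℚ 4 * (x * (q * 0ℚ)) ≡ 0ℚ
  4*[x*[q*0]]≡0 x = trans (cong (ℕ→ℚ 4 *_) (*-zeroʳ² x q)) (*-zeroʳ (ℕ→ℚ 4))
  ∂ᵥ-part : ∀ a b c → (u· ℕ→ℚ 4 ·ˢ ∂ᵥ (q ·ˢ 1ˢ)) a b c ≡ 0ℚ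
  ∂ᵥ-part a       zero          c = refl
  ∂ᵥ-part zero    (suc zero)    c = 4*[x*[q*0]]≡0 (ℕ→ℚ (suc c))
  ∂ᵥ-part zero    (suc (suc b)) c = 4*[x*[q*0]]≡0 (ℕ→ℚ (suc c))
  ∂ᵥ-part (suc a) (suc b)       c = 4*[x*[q*0]]≡0 (ℕ→ℚ (suc c))

δ-t : δ (t· 1ˢ) ≐ t· t· v· 1ˢ
δ-t = pointwise λ where
    zero    b c → refl
    (suc a) b c → trans (cong₂ _+_ (θ-part a b c) (∂ᵥ-part a b c)) (+-identityʳ _)
  where
  θ-part : ∀ a b c → (v· θ (t· 1ˢ)) a b c ≡ (t· v· 1ˢ) a b c
  θ-part zero          b       zero          = refl
  θ-part (suc a)       b       zero          = refl
  θ-part zero          b       (suc c)       = *-zeroʳ (ℕ→ℚ (2 *ℕ b))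
  θ-part (suc zero)    zero    (suc zero)    = refl
  θ-part (suc zero)    zero    (suc (suc c)) = *-zeroʳ (ℕ→ℚ 1)
  θ-part (suc zero)    (suc b) (suc c)       = *-zeroʳ (ℕ→ℚ (suc (2 *ℕ suc b)))
  θ-part (suc (suc a)) b       (suc c)       = *-zeroʳ (ℕ→ℚ (suc (suc a) +ℕ 2 *ℕ b))
  ∂ᵥ-part : ∀ a b c → (u· ℕ→ℚ 4 ·ˢ ∂ᵥ (t· 1ˢ)) a b c ≡ 0ℚ
  ∂ᵥ-part a             zero          c = refl
  ∂ᵥ-part zero          (suc b)       c = *-zeroʳ² (ℕ→ℚ 4) (ℕ→ℚ (suc c))
  ∂ᵥ-part (suc zero)    (suc zero)    c = *-zeroʳ² (ℕ→ℚ 4) (ℕ→ℚ (suc c))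
  ∂ᵥ-part (suc zero)    (suc (suc b)) c = *-zeroʳ² (ℕ→ℚ 4) (ℕ→ℚ (suc c))
  ∂ᵥ-part (suc (suc a)) (suc b)       c = *-zeroʳ² (ℕ→ℚ 4) (ℕ→ℚ (suc c))

δ-u : δ (u· 1ˢ) ≐ ℕ→ℚ 2 ·ˢ t· u· v· 1ˢ
δ-u = pointwise λ where
    zero    b c → sym (*-zeroʳ (ℕ→ℚ 2))
    (suc a) b c → trans (cong₂ _+_ (θ-part a b c) (∂ᵥ-part a b c)) (+-identityʳ _)
  where
  θ-part : ∀ a b c → (v· θ (u· 1ˢ)) a b c ≡ ℕ→ℚ 2 * (u· v· 1ˢ) a b c
  θ-part a       zero          zero          = sym (*-zeroʳ (ℕ→ℚ 2))
  θ-part a       (suc b)       zero          = sym (*-zeroʳ (ℕ→ℚ 2))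
  θ-part a       zero          (suc c)       =
    trans (*-zeroʳ (ℕ→ℚ (a +ℕ 0))) (sym (*-zeroʳ (ℕ→ℚ 2)))
  θ-part zero    (suc zero)    (suc zero)    = refl
  θ-part zero    (suc zero)    (suc (suc c)) = trans (*-zeroʳ (ℕ→ℚ 2)) (sym (*-zeroʳ (ℕ→ℚ 2)))
  θ-part zero    (suc (suc b)) (suc c)       =
    trans (*-zeroʳ (ℕ→ℚ (2 *ℕ suc (suc b)))) (sym (*-zeroʳ (ℕ→ℚ 2)))
  θ-part (suc a) (suc b)       (suc c)       =
    trans (*-zeroʳ (ℕ→ℚ (suc a +ℕ 2 *ℕ suc b))) (sym (*-zeroʳ (ℕ→ℚ 2)))
  ∂ᵥ-part : ∀ a b c → (u· ℕ→ℚ 4 ·ˢ ∂ᵥ (u· 1ˢ)) a b c ≡ 0ℚ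
  ∂ᵥ-part a       zero                c = refl
  ∂ᵥ-part a       (suc zero)          c = *-zeroʳ² (ℕ→ℚ 4) (ℕ→ℚ (suc c))
  ∂ᵥ-part zero    (suc (suc zero))    c = *-zeroʳ² (ℕ→ℚ 4) (ℕ→ℚ (suc c))
  ∂ᵥ-part zero    (suc (suc (suc b))) c = *-zeroʳ² (ℕ→ℚ 4) (ℕ→ℚ (suc c))
  ∂ᵥ-part (suc a) (suc (suc b))       c = *-zeroʳ² (ℕ→ℚ 4) (ℕ→ℚ (suc c))

δ-v : δ (v· 1ˢ) ≐ ℕ→ℚ 4 ·ˢ t· u· 1ˢ
δ-v = pointwise λ where
    zero    b c → sym (*-zeroʳ (ℕ→ℚ 4))
    (suc a) b c → trans (cong₂ _+_ (θ-part a b c) (∂ᵥ-part a b c)) (+-identityˡ _)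
  where
  θ-part : ∀ a b c → (v· θ (v· 1ˢ)) a b c ≡ 0ℚ
  θ-part a       b       zero                = refl
  θ-part a       b       (suc zero)          = *-zeroʳ (ℕ→ℚ (a +ℕ 2 *ℕ b))
  θ-part zero    zero    (suc (suc zero))    = refl
  θ-part zero    zero    (suc (suc (suc c))) = *-zeroʳ (ℕ→ℚ 0)
  θ-part zero    (suc b) (suc (suc c))       = *-zeroʳ (ℕ→ℚ (2 *ℕ suc b))
  θ-part (suc a) b       (suc (suc c))       = *-zeroʳ (ℕ→ℚ (suc a +ℕ 2 *ℕ b))
  ∂ᵥ-part : ∀ a b c → (u· ℕ→ℚ 4 ·ˢ ∂ᵥ (v· 1ˢ)) a b c ≡ ℕ→ℚ 4 * (u· 1ˢ) a b c
  ∂ᵥ-part a       zero          c       = sym (*-zeroʳ (ℕ→ℚ 4))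
  ∂ᵥ-part zero    (suc zero)    zero    = refl
  ∂ᵥ-part zero    (suc zero)    (suc c) = cong (ℕ→ℚ 4 *_) (*-zeroʳ (ℕ→ℚ (suc (suc c))))
  ∂ᵥ-part zero    (suc (suc b)) c       = cong (ℕ→ℚ 4 *_) (*-zeroʳ (ℕ→ℚ (suc c)))
  ∂ᵥ-part (suc a) (suc b)       c       = cong (ℕ→ℚ 4 *_) (*-zeroʳ (ℕ→ℚ (suc c)))

coeff-D : ∀ p → coeff (D p) ≐ δ (coeff p)
coeff-D (con q) = begin
  coeff (con 0ℚ)     ≈⟨ coeff-con 0ℚ ⟩
  0ℚ ·ˢ 1ˢ           ≈⟨ δ-const q ⟨
  δ (q ·ˢ 1ˢ)        ≈⟨ δ.≐-cong (coeff-con q) ⟨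
  δ (coeff (con q))  ∎
  where
  module δ = IsDerivation δ-isDerivation
  open ≐-Reasoning
coeff-D t = begin
  coeff t *ˢ coeff t *ˢ coeff v  ≈⟨ *ˢ-cong (*ˢ-cong coeff-t coeff-t) coeff-v ⟩
  t· 1ˢ *ˢ t· 1ˢ *ˢ v· 1ˢ        ≈⟨ *ˢ-congˡ (v· 1ˢ) (centralizer-*ˢ t·-isCentralizer (t· 1ˢ)) ⟩
  t· t· 1ˢ *ˢ v· 1ˢ              ≈⟨ centralizer-*ˢ (^-isCentralizer t·-isCentralizer 2) (v· 1ˢ) ⟩
  t· t· v· 1ˢ                    ≈⟨ δ-t ⟨
  δ (t· 1ˢ)                      ≈⟨ δ.≐-cong coeff-t ⟨
  δ (coeff t)                    ∎
  where
  module δ = IsDerivation δ-isDerivation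
  open ≐-Reasoning
coeff-D u = begin
  coeff (con (ℕ→ℚ 2)) *ˢ coeff t *ˢ coeff u *ˢ coeff v
    ≈⟨ *ˢ-cong (*ˢ-cong (*ˢ-cong (coeff-con (ℕ→ℚ 2)) coeff-t) coeff-u) coeff-v ⟩
  ℕ→ℚ 2 ·ˢ 1ˢ *ˢ t· 1ˢ *ˢ u· 1ˢ *ˢ v· 1ˢ
    ≈⟨ *ˢ-congˡ (v· 1ˢ) (*ˢ-congˡ (u· 1ˢ) (centralizer-*ˢ 2· (t· 1ˢ))) ⟩
  ℕ→ℚ 2 ·ˢ t· 1ˢ *ˢ u· 1ˢ *ˢ v· 1ˢ
    ≈⟨ *ˢ-congˡ (v· 1ˢ) (centralizer-*ˢ (∘-isCentralizer 2· t·-isCentralizer) (u· 1ˢ)) ⟩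
  ℕ→ℚ 2 ·ˢ t· u· 1ˢ *ˢ v· 1ˢ
    ≈⟨ centralizer-*ˢ (∘-isCentralizer 2· (∘-isCentralizer t·-isCentralizer u·-isCentralizer))
                      (v· 1ˢ) ⟩
  ℕ→ℚ 2 ·ˢ t· u· v· 1ˢ
    ≈⟨ δ-u ⟨
  δ (u· 1ˢ)
    ≈⟨ δ.≐-cong coeff-u ⟨
  δ (coeff u) ∎
  where
  2· : IsCentralizer (ℕ→ℚ 2 ·ˢ_)
  2· = ·ˢ-isCentralizer (ℕ→ℚ 2)
  module δ = IsDerivation δ-isDerivation
  open ≐-Reasoning
coeff-D v = begin
  coeff (con (ℕ→ℚ 4)) *ˢ coeff t *ˢ coeff u
    ≈⟨ *ˢ-cong (*ˢ-cong (coeff-con (ℕ→ℚ 4)) coeff-t) coeff-u ⟩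
  ℕ→ℚ 4 ·ˢ 1ˢ *ˢ t· 1ˢ *ˢ u· 1ˢ
    ≈⟨ *ˢ-congˡ (u· 1ˢ) (centralizer-*ˢ 4· (t· 1ˢ)) ⟩
  ℕ→ℚ 4 ·ˢ t· 1ˢ *ˢ u· 1ˢ
    ≈⟨ centralizer-*ˢ (∘-isCentralizer 4· t·-isCentralizer) (u· 1ˢ) ⟩
  ℕ→ℚ 4 ·ˢ t· u· 1ˢ
    ≈⟨ δ-v ⟨
  δ (v· 1ˢ)
    ≈⟨ δ.≐-cong coeff-v ⟨
  δ (coeff v) ∎
  where
  4· : IsCentralizer (ℕ→ℚ 4 ·ˢ_)
  4· = ·ˢ-isCentralizer (ℕ→ℚ 4)
  module δ = IsDerivation δ-isDerivation
  open ≐-Reasoning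
coeff-D (p ⊕ q) = ≐-trans (+ˢ-cong (coeff-D p) (coeff-D q))
                          (≐-sym (IsDerivation.+-homo δ-isDerivation (coeff p) (coeff q)))
coeff-D (p ⊗ q) =
  ≐-trans (+ˢ-cong (*ˢ-congˡ (coeff q) (coeff-D p)) (*ˢ-congʳ (coeff p) (coeff-D q)))
          (≐-sym (IsDerivation.leibniz δ-isDerivation (coeff p) (coeff q)))

-- Homogeneous slices

Slice : Set
Slice = ℕ → ℕ → ℚ

embed : Slice → Series
embed g zero    b c = g b c
embed g (suc _) _ _ = 0ℚ

infixr 8 t^_·_
t^_·_ : ℕ → Slice → Series
t^ n · g = (t·_ ^ n) (embed g)

t^-diag : ∀ n g b c → (t^ n · g) n b c ≡ g b c
t^-diag zero    g b c = refl
t^-diag (suc n) g b c = t^-diag n g b c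

t^-off : ∀ n g {a} → a ≢ n → ∀ b c → (t^ n · g) a b c ≡ 0ℚ
t^-off zero    g {zero}  a≢n b c = ⊥-elim (a≢n refl)
t^-off zero    g {suc a} a≢n b c = refl
t^-off (suc n) g {zero}  a≢n b c = refl
t^-off (suc n) g {suc a} a≢n b c = t^-off n g (a≢n ∘ cong suc) b c

t^-cong : ∀ n {g h : Slice} → (∀ b c → g b c ≡ h b c) → t^ n · g ≐ t^ n · h
t^-cong n g≗h = IsCentralizer.≐-cong (^-isCentralizer t·-isCentralizer n) (pointwise λ where
    zero    b c → g≗h b c
    (suc a) b c → refl)

·ˢ-t^ : ∀ q n (g : Slice) → q ·ˢ t^ n · g ≐ t^ n · (λ b c → q * g b c)
·ˢ-t^ q zero    g = pointwise λ where
  zero    b c → refl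
  (suc a) b c → *-zeroʳ q
·ˢ-t^ q (suc n) g = pointwise λ where
  zero    b c → *-zeroʳ q
  (suc a) b c → at (·ˢ-t^ q n g) a b c

δ[_] : ℕ → Slice → Slice
δ[ n ] g b c = v-part b c + u-part b c
  where
  v-part u-part : ℕ → ℕ → ℚ
  v-part b zero    = 0ℚ
  v-part b (suc c) = ℕ→ℚ (n +ℕ 2 *ℕ b) * g b c
  u-part zero    c = 0ℚ
  u-part (suc b) c = ℕ→ℚ 4 * (ℕ→ℚ (suc c) * g b (suc c))

δ-t^ : ∀ n g → δ (t^ n · g) ≐ t^ suc n · δ[ n ] g
δ-t^ n g = pointwise λ where
    zero    b c → refl
    (suc a) b c → on-or-off a b c (a ℕ.≟ n)
  where
  F : Series
  F = t^ n · g
  on : ∀ b c → δ F (suc n) b c ≡ δ[ n ] g b c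
  on zero    zero    = refl
  on (suc b) zero    = cong (λ x → 0ℚ + ℕ→ℚ 4 * (ℕ→ℚ 1 * x)) (t^-diag n g b 1)
  on zero    (suc c) = cong (λ x → ℕ→ℚ (n +ℕ 0) * x + 0ℚ) (t^-diag n g 0 c)
  on (suc b) (suc c) =
    cong₂ (λ x y → ℕ→ℚ (n +ℕ 2 *ℕ suc b) * x + ℕ→ℚ 4 * (ℕ→ℚ (suc (suc c)) * y))
          (t^-diag n g (suc b) c) (t^-diag n g b (suc (suc c)))
  off : ∀ a → a ≢ n → ∀ b c → δ F (suc a) b c ≡ 0ℚ
  off a a≢n b c = trans (cong₂ _+_ (v-part b c) (u-part b c)) (+-identityʳ 0ℚ)
    where
    v-part : ∀ b c → (v· θ F) a b c ≡ 0ℚ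
    v-part b zero    = refl
    v-part b (suc c) = trans (cong (ℕ→ℚ (a +ℕ 2 *ℕ b) *_) (t^-off n g a≢n b c))
                             (*-zeroʳ (ℕ→ℚ (a +ℕ 2 *ℕ b)))
    u-part : ∀ b c → (u· ℕ→ℚ 4 ·ˢ ∂ᵥ F) a b c ≡ 0ℚ
    u-part zero    c = refl
    u-part (suc b) c =
      trans (cong (λ x → ℕ→ℚ 4 * (ℕ→ℚ (suc c) * x)) (t^-off n g a≢n b (suc c)))
            (*-zeroʳ² (ℕ→ℚ 4) (ℕ→ℚ (suc c)))
  on-or-off : ∀ a b c → Dec (a ≡ n) → δ F (suc a) b c ≡ (t^ suc n · δ[ n ] g) (suc a) b c
  on-or-off a b c (yes refl) = trans (on b c) (sym (t^-diag n (δ[ n ] g) b c))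
  on-or-off a b c (no a≢n)   = trans (off a a≢n b c) (sym (t^-off n (δ[ n ] g) a≢n b c))

-- scaledCatalan k c is the coefficient of t^(n+1) u^(k+1) v^c in D^(n+1)(v/2), where n = 2k + c;
-- the recurrence is the one δ[_] imposes (δ[]-on-diagonal).
scaledCatalan : ℕ → ℕ → ℕ
scaledCatalan zero    zero    = 2
scaledCatalan zero    (suc c) = (3 +ℕ c) *ℕ scaledCatalan zero c
scaledCatalan (suc k) zero    = 4 *ℕ scaledCatalan k 1
scaledCatalan (suc k) (suc c) = (7 +ℕ 4 *ℕ k +ℕ c) *ℕ scaledCatalan (suc k) c
                              +ℕ 4 *ℕ (suc (suc c) *ℕ scaledCatalan k (suc (suc c)))

iterateSlice : ℕ → Slice
iterateSlice zero    zero    (suc zero) = ½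
iterateSlice zero    _       _          = 0ℚ
iterateSlice (suc m) zero    c          = 0ℚ
iterateSlice (suc m) (suc k) c          =
  if does (2 *ℕ k +ℕ c ℕ.≟ m) then ℕ→ℚ (scaledCatalan k c) else 0ℚ

iterateSlice-on : ∀ {m} k c → 2 *ℕ k +ℕ c ≡ m →
                  iterateSlice (suc m) (suc k) c ≡ ℕ→ℚ (scaledCatalan k c)
iterateSlice-on {m} k c on =
  cong (if_then ℕ→ℚ (scaledCatalan k c) else 0ℚ) (dec-true (2 *ℕ k +ℕ c ℕ.≟ m) on)

iterateSlice-off : ∀ {m} k c → 2 *ℕ k +ℕ c ≢ m → iterateSlice (suc m) (suc k) c ≡ 0ℚ
iterateSlice-off {m} k c off =
  cong (if_then ℕ→ℚ (scaledCatalan k c) else 0ℚ) (dec-false (2 *ℕ k +ℕ c ℕ.≟ m) off)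

δ[]-on-diagonal : ∀ m k c → 2 *ℕ k +ℕ c ≡ suc m →
                  δ[ suc m ] (iterateSlice (suc m)) (suc k) c ≡ ℕ→ℚ (scaledCatalan k c)
δ[]-on-diagonal m zero    zero    ()
δ[]-on-diagonal m zero    (suc c) refl = begin
  ℕ→ℚ w * iterateSlice (suc c) 1 c + ℕ→ℚ 4 * (ℕ→ℚ (suc (suc c)) * 0ℚ)
    ≡⟨ cong₂ _+_ (cong (ℕ→ℚ w *_) (iterateSlice-on 0 c refl))
                 (*-zeroʳ² (ℕ→ℚ 4) (ℕ→ℚ (suc (suc c)))) ⟩
  ℕ→ℚ w * ℕ→ℚ (scaledCatalan 0 c) + 0ℚ
    ≡⟨ +-identityʳ (ℕ→ℚ w * ℕ→ℚ (scaledCatalan 0 c)) ⟩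
  ℕ→ℚ w * ℕ→ℚ (scaledCatalan 0 c)
    ≡⟨ ℕ→ℚ-homo-* w (scaledCatalan 0 c) ⟨
  ℕ→ℚ (w *ℕ scaledCatalan 0 c)
    ≡⟨ cong (λ w → ℕ→ℚ (w *ℕ scaledCatalan 0 c)) (weight c) ⟩
  ℕ→ℚ (scaledCatalan 0 (suc c)) ∎
  where
  open ≡-Reasoning
  w : ℕ
  w = suc c +ℕ 2 *ℕ 1
  weight : ∀ c → suc c +ℕ 2 *ℕ 1 ≡ 3 +ℕ c
  weight = ℕ-solve-∀
δ[]-on-diagonal m (suc k) zero    on = begin
  0ℚ + ℕ→ℚ 4 * (ℕ→ℚ 1 * iterateSlice (suc m) (suc k) 1)
    ≡⟨ cong (λ x → 0ℚ + ℕ→ℚ 4 * (ℕ→ℚ 1 * x))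
            (iterateSlice-on k 1 (ℕ.suc-injective (trans (diag k) on))) ⟩
  0ℚ + ℕ→ℚ 4 * (ℕ→ℚ 1 * x)
    ≡⟨ +-identityˡ (ℕ→ℚ 4 * (ℕ→ℚ 1 * x)) ⟩
  ℕ→ℚ 4 * (ℕ→ℚ 1 * x)
    ≡⟨ cong (ℕ→ℚ 4 *_) (*-identityˡ x) ⟩
  ℕ→ℚ 4 * x
    ≡⟨ ℕ→ℚ-homo-* 4 (scaledCatalan k 1) ⟨
  ℕ→ℚ (scaledCatalan (suc k) zero) ∎
  where
  open ≡-Reasoning
  x : ℚ
  x = ℕ→ℚ (scaledCatalan k 1)
  diag : ∀ k → suc (2 *ℕ k +ℕ 1) ≡ 2 *ℕ suc k +ℕ 0
  diag = ℕ-solve-∀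
δ[]-on-diagonal m (suc k) (suc c) on = begin
  ℕ→ℚ w * iterateSlice (suc m) (suc (suc k)) c +
  ℕ→ℚ 4 * (ℕ→ℚ (suc (suc c)) * iterateSlice (suc m) (suc k) (suc (suc c)))
    ≡⟨ cong₂ (λ x y → ℕ→ℚ w * x + ℕ→ℚ 4 * (ℕ→ℚ (suc (suc c)) * y))
             (iterateSlice-on (suc k) c (ℕ.suc-injective (trans (diagᵥ k c) on)))
             (iterateSlice-on k (suc (suc c)) (ℕ.suc-injective (trans (diagᵤ k c) on))) ⟩
  ℕ→ℚ w * ℕ→ℚ (scaledCatalan (suc k) c) +
  ℕ→ℚ 4 * (ℕ→ℚ (suc (suc c)) * ℕ→ℚ (scaledCatalan k (suc (suc c))))
    ≡⟨ ℕ→ℚ-lincomb w (scaledCatalan (suc k) c) (suc (suc c)) (scaledCatalan k (suc (suc c))) ⟩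
  ℕ→ℚ (w *ℕ scaledCatalan (suc k) c +ℕ 4 *ℕ (suc (suc c) *ℕ scaledCatalan k (suc (suc c))))
    ≡⟨ cong (λ w → ℕ→ℚ (w *ℕ scaledCatalan (suc k) c +ℕ B)) weight ⟩
  ℕ→ℚ (scaledCatalan (suc k) (suc c)) ∎
  where
  open ≡-Reasoning
  w : ℕ
  w = suc m +ℕ 2 *ℕ suc (suc k)
  B : ℕ
  B = 4 *ℕ (suc (suc c) *ℕ scaledCatalan k (suc (suc c)))
  diagᵥ : ∀ k c → suc (2 *ℕ suc k +ℕ c) ≡ 2 *ℕ suc k +ℕ suc c
  diagᵥ = ℕ-solve-∀
  diagᵤ : ∀ k c → suc (2 *ℕ k +ℕ suc (suc c)) ≡ 2 *ℕ suc k +ℕ suc c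
  diagᵤ = ℕ-solve-∀
  expand : ∀ k c → 2 *ℕ suc k +ℕ suc c +ℕ 2 *ℕ suc (suc k) ≡ 7 +ℕ 4 *ℕ k +ℕ c
  expand = ℕ-solve-∀
  weight : w ≡ 7 +ℕ 4 *ℕ k +ℕ c
  weight = trans (cong (_+ℕ 2 *ℕ suc (suc k)) (sym on)) (expand k c)

δ[]-off-diagonal : ∀ m k c → 2 *ℕ k +ℕ c ≢ suc m →
                   δ[ suc m ] (iterateSlice (suc m)) (suc k) c ≡ 0ℚ
δ[]-off-diagonal m zero    zero    off = refl
δ[]-off-diagonal m zero    (suc c) off = trans
  (cong₂ _+_ (trans (cong (ℕ→ℚ (suc m +ℕ 2 *ℕ 1) *_) (iterateSlice-off 0 c (off ∘ cong suc)))
                    (*-zeroʳ (ℕ→ℚ (suc m +ℕ 2 *ℕ 1))))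
             (*-zeroʳ² (ℕ→ℚ 4) (ℕ→ℚ (suc (suc c)))))
  (+-identityʳ 0ℚ)
δ[]-off-diagonal m (suc k) zero    off = trans
  (cong (λ x → 0ℚ + ℕ→ℚ 4 * (ℕ→ℚ 1 * x)) (iterateSlice-off k 1 (off ∘ trans (diag k) ∘ cong suc)))
  (trans (+-identityˡ (ℕ→ℚ 4 * (ℕ→ℚ 1 * 0ℚ))) (*-zeroʳ² (ℕ→ℚ 4) (ℕ→ℚ 1)))
  where
  diag : ∀ k → 2 *ℕ suc k +ℕ 0 ≡ suc (2 *ℕ k +ℕ 1)
  diag = ℕ-solve-∀
δ[]-off-diagonal m (suc k) (suc c) off = trans
  (cong₂ _+_ (trans (cong (ℕ→ℚ w *_)
                          (iterateSlice-off (suc k) c (off ∘ trans (diagᵥ k c) ∘ cong suc)))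
                    (*-zeroʳ (ℕ→ℚ w)))
             (trans (cong (λ y → ℕ→ℚ 4 * (ℕ→ℚ (suc (suc c)) * y))
                          (iterateSlice-off k (suc (suc c)) (off ∘ trans (diagᵤ k c) ∘ cong suc)))
                    (*-zeroʳ² (ℕ→ℚ 4) (ℕ→ℚ (suc (suc c))))))
  (+-identityʳ 0ℚ)
  where
  w : ℕ
  w = suc m +ℕ 2 *ℕ suc (suc k)
  diagᵥ : ∀ k c → 2 *ℕ suc k +ℕ suc c ≡ suc (2 *ℕ suc k +ℕ c)
  diagᵥ = ℕ-solve-∀
  diagᵤ : ∀ k c → 2 *ℕ suc k +ℕ suc c ≡ suc (2 *ℕ k +ℕ suc (suc c))
  diagᵤ = ℕ-solve-∀

iterateSlice-step : ∀ n b c → δ[ n ] (iterateSlice n) b c ≡ iterateSlice (suc n) b c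
iterateSlice-step zero    zero          zero          = refl
iterateSlice-step zero    zero          (suc zero)    = refl
iterateSlice-step zero    zero          (suc (suc c)) =
  trans (+-identityʳ (ℕ→ℚ 0 * iterateSlice 0 0 (suc c))) (*-zeroˡ (iterateSlice 0 0 (suc c)))
iterateSlice-step zero    (suc zero)    zero          = refl
iterateSlice-step zero    (suc (suc b)) zero          = refl
iterateSlice-step zero    (suc zero)    (suc c)       =
  trans (cong₂ _+_ (*-zeroʳ (ℕ→ℚ 2)) (*-zeroʳ² (ℕ→ℚ 4) (ℕ→ℚ (suc (suc c))))) (+-identityʳ 0ℚ)
iterateSlice-step zero    (suc (suc b)) (suc c)       = trans
  (cong₂ _+_ (*-zeroʳ (ℕ→ℚ (2 *ℕ suc (suc b)))) (*-zeroʳ² (ℕ→ℚ 4) (ℕ→ℚ (suc (suc c)))))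
  (trans (+-identityʳ 0ℚ) (sym (iterateSlice-off (suc b) (suc c) (ℕ.m+1+n≢0 (2 *ℕ suc b)))))
iterateSlice-step (suc m) zero          zero          = refl
iterateSlice-step (suc m) zero          (suc c)       =
  trans (+-identityʳ (ℕ→ℚ (suc m +ℕ 0) * 0ℚ)) (*-zeroʳ (ℕ→ℚ (suc m +ℕ 0)))
iterateSlice-step (suc m) (suc k)       c             with 2 *ℕ k +ℕ c ℕ.≟ suc m
... | yes on = trans (δ[]-on-diagonal m k c on) (sym (iterateSlice-on k c on))
... | no off = trans (δ[]-off-diagonal m k c off) (sym (iterateSlice-off k c off))

coeff-Dⁿ-½v : ∀ n → coeff (Dⁿ n (con ½ ⊗ v)) ≐ t^ n · iterateSlice n
coeff-Dⁿ-½v zero = begin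
  coeff (con ½) *ˢ coeff v  ≈⟨ *ˢ-cong (coeff-con ½) coeff-v ⟩
  ½ ·ˢ 1ˢ *ˢ v· 1ˢ          ≈⟨ centralizer-*ˢ (·ˢ-isCentralizer ½) (v· 1ˢ) ⟩
  ½ ·ˢ v· 1ˢ                ≈⟨ pointwise half-v ⟩
  t^ 0 · iterateSlice 0     ∎
  where
  open ≐-Reasoning
  half-v : ∀ a b c → ½ * (v· 1ˢ) a b c ≡ (t^ 0 · iterateSlice 0) a b c
  half-v zero    zero    zero          = refl
  half-v zero    zero    (suc zero)    = refl
  half-v zero    zero    (suc (suc c)) = refl
  half-v zero    (suc b) zero          = refl
  half-v zero    (suc b) (suc c)       = refl
  half-v (suc a) b       zero          = refl
  half-v (suc a) b       (suc c)       = refl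
coeff-Dⁿ-½v (suc n) = begin
  coeff (D (Dⁿ n (con ½ ⊗ v)))        ≈⟨ coeff-D (Dⁿ n (con ½ ⊗ v)) ⟩
  δ (coeff (Dⁿ n (con ½ ⊗ v)))        ≈⟨ IsDerivation.≐-cong δ-isDerivation (coeff-Dⁿ-½v n) ⟩
  δ (t^ n · iterateSlice n)           ≈⟨ δ-t^ n (iterateSlice n) ⟩
  t^ suc n · δ[ n ] (iterateSlice n)  ≈⟨ t^-cong (suc n) (iterateSlice-step n) ⟩
  t^ suc n · iterateSlice (suc n)     ∎
  where open ≐-Reasoning

-- The factorial closed form

scaledCatalan-factorials : ∀ k c →
  scaledCatalan k c *ℕ (k ! *ℕ suc k ! *ℕ c !) ≡ (2 +ℕ (2 *ℕ k +ℕ c)) ! *ℕ (2 *ℕ k +ℕ c) !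
scaledCatalan-factorials k c = go k c refl
  where
  open ≡-Reasoning
  next : ∀ n → (3 +ℕ n) *ℕ (1 +ℕ n) *ℕ ((2 +ℕ n) ! *ℕ n !) ≡ (2 +ℕ suc n) ! *ℕ suc n !
  next n = lemma n ((2 +ℕ n) !) (n !)
    where
    lemma : ∀ n P Q → (3 +ℕ n) *ℕ (1 +ℕ n) *ℕ (P *ℕ Q) ≡ (3 +ℕ n) *ℕ P *ℕ ((1 +ℕ n) *ℕ Q)
    lemma = ℕ-solve-∀
  go : ∀ {n} k c → 2 *ℕ k +ℕ c ≡ n →
       scaledCatalan k c *ℕ (k ! *ℕ suc k ! *ℕ c !) ≡ (2 +ℕ n) ! *ℕ n !
  go zero    zero    refl = refl
  go zero    (suc c) refl = begin
    (3 +ℕ c) *ℕ A *ℕ (1 *ℕ 1 *ℕ suc c !)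
      ≡⟨ shuffle c A (c !) ⟩
    (3 +ℕ c) *ℕ (1 +ℕ c) *ℕ (A *ℕ (1 *ℕ 1 *ℕ c !))
      ≡⟨ cong ((3 +ℕ c) *ℕ (1 +ℕ c) *ℕ_) (go 0 c refl) ⟩
    (3 +ℕ c) *ℕ (1 +ℕ c) *ℕ ((2 +ℕ c) ! *ℕ c !)
      ≡⟨ next c ⟩
    (2 +ℕ suc c) ! *ℕ suc c ! ∎
    where
    A : ℕ
    A = scaledCatalan 0 c
    shuffle : ∀ c A a → (3 +ℕ c) *ℕ A *ℕ (1 *ℕ 1 *ℕ ((1 +ℕ c) *ℕ a)) ≡
                        (3 +ℕ c) *ℕ (1 +ℕ c) *ℕ (A *ℕ (1 *ℕ 1 *ℕ a))
    shuffle = ℕ-solve-∀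
  go (suc k) zero    refl = begin
    4 *ℕ A *ℕ (suc k ! *ℕ suc (suc k) ! *ℕ 1)
      ≡⟨ shuffle k A (k !) ⟩
    4 *ℕ (1 +ℕ k) *ℕ (2 +ℕ k) *ℕ (A *ℕ (k ! *ℕ suc k ! *ℕ 1 !))
      ≡⟨ cong (4 *ℕ (1 +ℕ k) *ℕ (2 +ℕ k) *ℕ_) (go k 1 refl) ⟩
    4 *ℕ (1 +ℕ k) *ℕ (2 +ℕ k) *ℕ ((2 +ℕ n₁) ! *ℕ n₁ !)
      ≡⟨ weights k ((2 +ℕ n₁) ! *ℕ n₁ !) ⟩
    (3 +ℕ n₁) *ℕ (1 +ℕ n₁) *ℕ ((2 +ℕ n₁) ! *ℕ n₁ !)
      ≡⟨ next n₁ ⟩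
    (2 +ℕ suc n₁) ! *ℕ suc n₁ !
      ≡⟨ cong (λ n → (2 +ℕ n) ! *ℕ n !) (diag k) ⟩
    (2 +ℕ (2 *ℕ suc k +ℕ 0)) ! *ℕ (2 *ℕ suc k +ℕ 0) ! ∎
    where
    A : ℕ
    A = scaledCatalan k 1
    n₁ : ℕ
    n₁ = 2 *ℕ k +ℕ 1
    shuffle : ∀ k A a → 4 *ℕ A *ℕ ((1 +ℕ k) *ℕ a *ℕ ((2 +ℕ k) *ℕ ((1 +ℕ k) *ℕ a)) *ℕ 1) ≡
                        4 *ℕ (1 +ℕ k) *ℕ (2 +ℕ k) *ℕ (A *ℕ (a *ℕ ((1 +ℕ k) *ℕ a) *ℕ 1))
    shuffle = ℕ-solve-∀
    weights : ∀ k X → 4 *ℕ (1 +ℕ k) *ℕ (2 +ℕ k) *ℕ X ≡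
                      (3 +ℕ (2 *ℕ k +ℕ 1)) *ℕ (1 +ℕ (2 *ℕ k +ℕ 1)) *ℕ X
    weights = ℕ-solve-∀
    diag : ∀ k → suc (2 *ℕ k +ℕ 1) ≡ 2 *ℕ suc k +ℕ 0
    diag = ℕ-solve-∀
  go (suc k) (suc c) refl = begin
    (W *ℕ A +ℕ 4 *ℕ (suc (suc c) *ℕ B)) *ℕ (suc k ! *ℕ suc (suc k) ! *ℕ suc c !)
      ≡⟨ shuffle k c W A B (k !) (c !) ⟩
    W *ℕ (1 +ℕ c) *ℕ (A *ℕ (suc k ! *ℕ suc (suc k) ! *ℕ c !)) +ℕ
    4 *ℕ ((1 +ℕ k) *ℕ (2 +ℕ k)) *ℕ (B *ℕ (k ! *ℕ suc k ! *ℕ suc (suc c) !))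
      ≡⟨ cong₂ (λ x y → W *ℕ (1 +ℕ c) *ℕ x +ℕ 4 *ℕ ((1 +ℕ k) *ℕ (2 +ℕ k)) *ℕ y)
               (go (suc k) c refl) (go k (suc (suc c)) (diag k c)) ⟩
    W *ℕ (1 +ℕ c) *ℕ X +ℕ 4 *ℕ ((1 +ℕ k) *ℕ (2 +ℕ k)) *ℕ X
      ≡⟨ weights k c X ⟩
    (3 +ℕ n₁) *ℕ (1 +ℕ n₁) *ℕ X
      ≡⟨ next n₁ ⟩
    (2 +ℕ suc n₁) ! *ℕ suc n₁ !
      ≡⟨ cong (λ n → (2 +ℕ n) ! *ℕ n !) (diag′ k c) ⟩
    (2 +ℕ (2 *ℕ suc k +ℕ suc c)) ! *ℕ (2 *ℕ suc k +ℕ suc c) ! ∎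
    where
    W : ℕ
    W = 7 +ℕ 4 *ℕ k +ℕ c
    A : ℕ
    A = scaledCatalan (suc k) c
    B : ℕ
    B = scaledCatalan k (suc (suc c))
    n₁ : ℕ
    n₁ = 2 *ℕ suc k +ℕ c
    X : ℕ
    X = (2 +ℕ n₁) ! *ℕ n₁ !
    shuffle : ∀ k c W A B a b →
      (W *ℕ A +ℕ 4 *ℕ ((2 +ℕ c) *ℕ B)) *ℕ
        ((1 +ℕ k) *ℕ a *ℕ ((2 +ℕ k) *ℕ ((1 +ℕ k) *ℕ a)) *ℕ ((1 +ℕ c) *ℕ b)) ≡
      W *ℕ (1 +ℕ c) *ℕ (A *ℕ ((1 +ℕ k) *ℕ a *ℕ ((2 +ℕ k) *ℕ ((1 +ℕ k) *ℕ a)) *ℕ b)) +ℕ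
      4 *ℕ ((1 +ℕ k) *ℕ (2 +ℕ k)) *ℕ (B *ℕ (a *ℕ ((1 +ℕ k) *ℕ a) *ℕ ((2 +ℕ c) *ℕ ((1 +ℕ c) *ℕ b))))
    shuffle = ℕ-solve-∀
    weights : ∀ k c X → (7 +ℕ 4 *ℕ k +ℕ c) *ℕ (1 +ℕ c) *ℕ X +ℕ 4 *ℕ ((1 +ℕ k) *ℕ (2 +ℕ k)) *ℕ X ≡
                        (3 +ℕ (2 *ℕ suc k +ℕ c)) *ℕ (1 +ℕ (2 *ℕ suc k +ℕ c)) *ℕ X
    weights = ℕ-solve-∀
    diag : ∀ k c → 2 *ℕ k +ℕ suc (suc c) ≡ 2 *ℕ suc k +ℕ c
    diag = ℕ-solve-∀
    diag′ : ∀ k c → suc (2 *ℕ suc k +ℕ c) ≡ 2 *ℕ suc k +ℕ suc c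
    diag′ = ℕ-solve-∀

nCk*k!*[n∸k]!≡n! : ∀ {n k} → k ≤ n → (n C k) *ℕ (k ! *ℕ (n ∸ k) !) ≡ n !
nCk*k!*[n∸k]!≡n! {n} {k} k≤n = trans (cong (_*ℕ (k ! *ℕ (n ∸ k) !)) (nCk≡n!/k![n-k]! k≤n))
  (m/n*n≡m {{ℕ._!*_!≢0 k (n ∸ k)}} (k![n∸k]!∣n! k≤n))

binomial-Catalan-factorials : ∀ k c →
  ((2 *ℕ k +ℕ c) C (2 *ℕ k)) *ℕ (((2 *ℕ k) C k) *ℕ (k ! *ℕ k ! *ℕ c !)) ≡ (2 *ℕ k +ℕ c) !
binomial-Catalan-factorials k c = begin
  ((2 *ℕ k +ℕ c) C (2 *ℕ k)) *ℕ (((2 *ℕ k) C k) *ℕ (k ! *ℕ k ! *ℕ c !))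
    ≡⟨ cong (((2 *ℕ k +ℕ c) C (2 *ℕ k)) *ℕ_) (sym (ℕ.*-assoc ((2 *ℕ k) C k) (k ! *ℕ k !) (c !))) ⟩
  ((2 *ℕ k +ℕ c) C (2 *ℕ k)) *ℕ (((2 *ℕ k) C k) *ℕ (k ! *ℕ k !) *ℕ c !)
    ≡⟨ cong (λ x → ((2 *ℕ k +ℕ c) C (2 *ℕ k)) *ℕ (x *ℕ c !)) central ⟩
  ((2 *ℕ k +ℕ c) C (2 *ℕ k)) *ℕ ((2 *ℕ k) ! *ℕ c !)
    ≡⟨ cong (λ x → ((2 *ℕ k +ℕ c) C (2 *ℕ k)) *ℕ ((2 *ℕ k) ! *ℕ x !)) (ℕ.m+n∸m≡n (2 *ℕ k) c) ⟨
  ((2 *ℕ k +ℕ c) C (2 *ℕ k)) *ℕ ((2 *ℕ k) ! *ℕ (2 *ℕ k +ℕ c ∸ 2 *ℕ k) !)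
    ≡⟨ nCk*k!*[n∸k]!≡n! (ℕ.m≤m+n (2 *ℕ k) c) ⟩
  (2 *ℕ k +ℕ c) ! ∎
  where
  open ≡-Reasoning
  2k∸k≡k : 2 *ℕ k ∸ k ≡ k
  2k∸k≡k = trans (ℕ.m+n∸m≡n k (k +ℕ 0)) (ℕ.+-identityʳ k)
  central : ((2 *ℕ k) C k) *ℕ (k ! *ℕ k !) ≡ (2 *ℕ k) !
  central = trans (cong (λ x → ((2 *ℕ k) C k) *ℕ (k ! *ℕ x !)) (sym 2k∸k≡k))
                  (nCk*k!*[n∸k]!≡n! (ℕ.m≤m+n k (k +ℕ 0)))

M-coefficient : ℕ → ℕ → ℚ
M-coefficient m k = ℕ→ℚ (m C (2 *ℕ k)) * Catalan k

scaledCatalan-closed-form : ∀ k c → let n = 2 *ℕ k +ℕ c in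
  ℕ→ℚ (scaledCatalan k c) ≡ ℕ→ℚ ((2 +ℕ n) !) * M-coefficient n k
scaledCatalan-closed-form k c = *-cancelʳ-ℕ→ℚ d {{d≢0}} (begin
  ℕ→ℚ (scaledCatalan k c) * ℕ→ℚ d
    ≡⟨ ℕ→ℚ-homo-* (scaledCatalan k c) d ⟨
  ℕ→ℚ (scaledCatalan k c *ℕ d)
    ≡⟨ cong ℕ→ℚ (scaledCatalan-factorials k c) ⟩
  ℕ→ℚ ((2 +ℕ n) ! *ℕ n !)
    ≡⟨ cong (λ x → ℕ→ℚ ((2 +ℕ n) ! *ℕ x)) (binomial-Catalan-factorials k c) ⟨
  ℕ→ℚ (P *ℕ (B *ℕ (B′ *ℕ (k ! *ℕ k ! *ℕ c !))))
    ≡⟨ ℕ→ℚ-expand ⟩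
  ℕ→ℚ P * (ℕ→ℚ B * (ℕ→ℚ B′ * (ℕ→ℚ (k !) * ℕ→ℚ (k !) * ℕ→ℚ (c !))))
    ≡⟨ cong (λ x → ℕ→ℚ P * (ℕ→ℚ B * (x * (ℕ→ℚ (k !) * ℕ→ℚ (k !) * ℕ→ℚ (c !))))) (Catalan-*-suc k) ⟨
  ℕ→ℚ P * (ℕ→ℚ B * (Catalan k * ℕ→ℚ (suc k) * (ℕ→ℚ (k !) * ℕ→ℚ (k !) * ℕ→ℚ (c !))))
    ≡⟨ shuffle (ℕ→ℚ P) (ℕ→ℚ B) (Catalan k) (ℕ→ℚ (suc k)) (ℕ→ℚ (k !)) (ℕ→ℚ (c !)) ⟩
  ℕ→ℚ P * (ℕ→ℚ B * Catalan k) * (ℕ→ℚ (k !) * (ℕ→ℚ (suc k) * ℕ→ℚ (k !)) * ℕ→ℚ (c !))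
    ≡⟨ cong (ℕ→ℚ P * (ℕ→ℚ B * Catalan k) *_) ℕ→ℚ-d ⟨
  ℕ→ℚ P * (ℕ→ℚ B * Catalan k) * ℕ→ℚ d ∎)
  where
  open ≡-Reasoning
  n : ℕ
  n = 2 *ℕ k +ℕ c
  P : ℕ
  P = (2 +ℕ n) !
  B : ℕ
  B = n C (2 *ℕ k)
  B′ : ℕ
  B′ = (2 *ℕ k) C k
  d : ℕ
  d = k ! *ℕ suc k ! *ℕ c !
  d≢0 : ℕ.NonZero d
  d≢0 = ℕ.m*n≢0 (k ! *ℕ suc k !) (c !) {{ℕ._!*_!≢0 k (suc k)}} {{ℕ._!≢0 c}}
  ℕ→ℚ-d : ℕ→ℚ d ≡ ℕ→ℚ (k !) * (ℕ→ℚ (suc k) * ℕ→ℚ (k !)) * ℕ→ℚ (c !)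
  ℕ→ℚ-d = trans (ℕ→ℚ-homo-* (k ! *ℕ suc k !) (c !))
            (cong (_* ℕ→ℚ (c !)) (trans (ℕ→ℚ-homo-* (k !) (suc k !))
                                         (cong (ℕ→ℚ (k !) *_) (ℕ→ℚ-homo-* (suc k) (k !)))))
  ℕ→ℚ-expand : ℕ→ℚ (P *ℕ (B *ℕ (B′ *ℕ (k ! *ℕ k ! *ℕ c !)))) ≡
               ℕ→ℚ P * (ℕ→ℚ B * (ℕ→ℚ B′ * (ℕ→ℚ (k !) * ℕ→ℚ (k !) * ℕ→ℚ (c !))))
  ℕ→ℚ-expand =
    trans (ℕ→ℚ-homo-* P _) (cong (ℕ→ℚ P *_)
    (trans (ℕ→ℚ-homo-* B _) (cong (ℕ→ℚ B *_)
    (trans (ℕ→ℚ-homo-* B′ _) (cong (ℕ→ℚ B′ *_)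
    (trans (ℕ→ℚ-homo-* (k ! *ℕ k !) (c !)) (cong (_* ℕ→ℚ (c !)) (ℕ→ℚ-homo-* (k !) (k !)))))))))
  shuffle : ∀ p b γ s f g → p * (b * (γ * s * (f * f * g))) ≡ p * (b * γ) * (f * (s * f) * g)
  shuffle = solve-∀ ℚ-ring

kron : ℕ → ℕ → ℚ
kron zero    zero    = 1ℚ
kron zero    (suc _) = 0ℚ
kron (suc _) zero    = 0ℚ
kron (suc i) (suc j) = kron i j

kron-refl : ∀ i → kron i i ≡ 1ℚ
kron-refl zero    = refl
kron-refl (suc i) = kron-refl i

kron-≢ : ∀ {i j} → i ≢ j → kron i j ≡ 0ℚ
kron-≢ {zero}  {zero}  i≢j = ⊥-elim (i≢j refl)
kron-≢ {zero}  {suc j} _   = refl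
kron-≢ {suc i} {zero}  _   = refl
kron-≢ {suc i} {suc j} i≢j = kron-≢ (i≢j ∘ cong suc)

*-kron-≢ˡ : ∀ q {i j} y → i ≢ j → q * (kron i j * y) ≡ 0ℚ
*-kron-≢ˡ q y i≢j =
  trans (cong (λ x → q * (x * y)) (kron-≢ i≢j)) (trans (cong (q *_) (*-zeroˡ y)) (*-zeroʳ q))

*-kron-≢ʳ : ∀ q x {i j} → i ≢ j → q * (x * kron i j) ≡ 0ℚ
*-kron-≢ʳ q x i≢j = trans (cong (λ y → q * (x * y)) (kron-≢ i≢j)) (*-zeroʳ² q x)

uv-monomial : ∀ β γ → (u·_ ^ β) ((v·_ ^ γ) 1ˢ) ≐ t^ 0 · (λ b c → kron β b * kron γ c)
uv-monomial β γ = pointwise (go β γ)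
  where
  go : ∀ β γ a b c → (u·_ ^ β) ((v·_ ^ γ) 1ˢ) a b c ≡ (t^ 0 · (λ b c → kron β b * kron γ c)) a b c
  go (suc β) γ       zero    zero    c       = sym (*-zeroˡ (kron γ c))
  go (suc β) γ       (suc a) zero    c       = refl
  go (suc β) γ       zero    (suc b) c       = go β γ zero b c
  go (suc β) γ       (suc a) (suc b) c       = go β γ (suc a) b c
  go zero    (suc γ) zero    b       zero    = sym (*-zeroʳ (kron 0 b))
  go zero    (suc γ) (suc a) b       zero    = refl
  go zero    (suc γ) zero    b       (suc c) = go zero γ zero b c
  go zero    (suc γ) (suc a) b       (suc c) = go zero γ (suc a) b c
  go zero    zero    zero    zero    zero    = refl
  go zero    zero    zero    zero    (suc c) = refl
  go zero    zero    zero    (suc b) c       = sym (*-zeroˡ (kron 0 c))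
  go zero    zero    (suc a) b       c       = refl

coeff-pow : ∀ x {S} → IsCentralizer S → coeff x ≐ S 1ˢ → ∀ n → coeff (pow x n) ≐ (S ^ n) 1ˢ
coeff-pow x     S-central coeff-x zero    =
  ≐-trans (coeff-con 1ℚ) (pointwise λ a b c → *-identityˡ (1ˢ a b c))
coeff-pow x {S} S-central coeff-x (suc n) =
  ≐-trans (*ˢ-cong coeff-x (coeff-pow x S-central coeff-x n))
          (centralizer-*ˢ S-central ((S ^ n) 1ˢ))

coeff-ΣP : ∀ K f a b c → coeff (ΣP K f) a b c ≡ Σ≤ K (λ k → coeff (f k) a b c)
coeff-ΣP zero    f a b c = refl
coeff-ΣP (suc K) f a b c = cong (_+ coeff (f (suc K)) a b c) (coeff-ΣP K f a b c)

coeff-uv-term : ∀ q β γ →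
  coeff (con q ⊗ pow u β ⊗ pow v γ) ≐ t^ 0 · (λ b c → q * (kron β b * kron γ c))
coeff-uv-term q β γ = begin
  coeff (con q) *ˢ coeff (pow u β) *ˢ coeff (pow v γ)
    ≈⟨ *ˢ-cong (*ˢ-cong (coeff-con q) (coeff-pow u u·-isCentralizer coeff-u β))
               (coeff-pow v v·-isCentralizer coeff-v γ) ⟩
  q ·ˢ 1ˢ *ˢ (u·_ ^ β) 1ˢ *ˢ (v·_ ^ γ) 1ˢ
    ≈⟨ *ˢ-congˡ ((v·_ ^ γ) 1ˢ) (centralizer-*ˢ (·ˢ-isCentralizer q) ((u·_ ^ β) 1ˢ)) ⟩
  q ·ˢ (u·_ ^ β) 1ˢ *ˢ (v·_ ^ γ) 1ˢ
    ≈⟨ centralizer-*ˢ (∘-isCentralizer (·ˢ-isCentralizer q) (^-isCentralizer u·-isCentralizer β))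
                      ((v·_ ^ γ) 1ˢ) ⟩
  q ·ˢ (u·_ ^ β) ((v·_ ^ γ) 1ˢ)
    ≈⟨ IsCentralizer.≐-cong (·ˢ-isCentralizer q) (uv-monomial β γ) ⟩
  q ·ˢ t^ 0 · (λ b c → kron β b * kron γ c)
    ≈⟨ ·ˢ-t^ q 0 (λ b c → kron β b * kron γ c) ⟩
  t^ 0 · (λ b c → q * (kron β b * kron γ c)) ∎
  where open ≐-Reasoning

M-term : ℕ → ℕ → Slice
M-term m k b c = M-coefficient m k * (kron (suc k) b * kron (m ∸ 2 *ℕ k) c)

M-slice : ℕ → Slice
M-slice m b c = Σ≤ (m /ℕ 2) λ k → M-term m k b c

coeff-M : ∀ m → coeff (M m) ≐ t^ 0 · M-slice m
coeff-M m = pointwise λ a b c → trans (coeff-ΣP (m /ℕ 2) _ a b c) (trans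
  (Σ≤-cong (m /ℕ 2) λ k _ → at (coeff-uv-term (M-coefficient m k) (suc k) (m ∸ 2 *ℕ k)) a b c)
  (embed-Σ a b c))
  where
  embed-Σ : ∀ a b c → Σ≤ (m /ℕ 2) (λ k → (t^ 0 · M-term m k) a b c) ≡ (t^ 0 · M-slice m) a b c
  embed-Σ zero    b c = refl
  embed-Σ (suc a) b c = Σ≤-zero (m /ℕ 2) λ _ _ → refl

coeff-N⊗tⁿ⊗M : ∀ m → let N = ℕ→ℚ (suc (suc m) !) in
  coeff (con N ⊗ pow t (suc m) ⊗ M m) ≐ t^ suc m · (λ b c → N * M-slice m b c)
coeff-N⊗tⁿ⊗M m = begin
  coeff (con N) *ˢ coeff (pow t (suc m)) *ˢ coeff (M m)
    ≈⟨ *ˢ-cong (*ˢ-cong (coeff-con N) (coeff-pow t t·-isCentralizer coeff-t (suc m)))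
               (coeff-M m) ⟩
  N ·ˢ 1ˢ *ˢ (t·_ ^ suc m) 1ˢ *ˢ t^ 0 · M-slice m
    ≈⟨ *ˢ-congˡ (t^ 0 · M-slice m) (centralizer-*ˢ (·ˢ-isCentralizer N) ((t·_ ^ suc m) 1ˢ)) ⟩
  N ·ˢ (t·_ ^ suc m) 1ˢ *ˢ t^ 0 · M-slice m
    ≈⟨ centralizer-*ˢ (∘-isCentralizer (·ˢ-isCentralizer N)
                                       (^-isCentralizer t·-isCentralizer (suc m)))
                      (t^ 0 · M-slice m) ⟩
  N ·ˢ t^ suc m · M-slice m
    ≈⟨ ·ˢ-t^ N (suc m) (M-slice m) ⟩
  t^ suc m · (λ b c → N * M-slice m b c) ∎
  where
  N : ℚ
  N = ℕ→ℚ (suc (suc m) !)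
  open ≐-Reasoning

2*k≤m⇒k≤m/2 : ∀ {k m} → 2 *ℕ k ≤ m → k ≤ m /ℕ 2
2*k≤m⇒k≤m/2 {k} {m} 2k≤m =
  subst (_≤ m /ℕ 2) (m*n/n≡m k 2) (/-monoˡ-≤ 2 (subst (_≤ m) (ℕ.*-comm 2 k) 2k≤m))

k≤m/2⇒2*k≤m : ∀ {k m} → k ≤ m /ℕ 2 → 2 *ℕ k ≤ m
k≤m/2⇒2*k≤m {k} {m} k≤m/2 =
  ℕ.≤-trans (ℕ.*-monoʳ-≤ 2 k≤m/2) (subst (_≤ m) (ℕ.*-comm (m /ℕ 2) 2) (m/n*n≤m m 2))

M-slice≡iterateSlice : ∀ m b c → ℕ→ℚ (suc (suc m) !) * M-slice m b c ≡ iterateSlice (suc m) b c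
M-slice≡iterateSlice m zero    c = trans
  (cong (N *_) (Σ≤-zero (m /ℕ 2) λ k _ →
    *-kron-≢ˡ (M-coefficient m k) {suc k} {0} (kron (m ∸ 2 *ℕ k) c) λ ()))
  (*-zeroʳ N)
  where N = ℕ→ℚ (suc (suc m) !)
M-slice≡iterateSlice m (suc j) c with 2 *ℕ j +ℕ c ℕ.≟ m
... | yes refl = begin
  N * Σ≤ (m /ℕ 2) (λ k → M-term m k (suc j) c)
    ≡⟨ cong (N *_) (Σ≤-single (m /ℕ 2) j _ (2*k≤m⇒k≤m/2 (ℕ.m≤m+n (2 *ℕ j) c)) λ k k≢j →
         *-kron-≢ˡ (M-coefficient m k) (kron (m ∸ 2 *ℕ k) c) k≢j) ⟩
  N * (M-coefficient m j * (kron j j * kron (m ∸ 2 *ℕ j) c))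
    ≡⟨ cong (λ x → N * (M-coefficient m j * x))
            (cong₂ _*_ (kron-refl j)
                       (trans (cong (λ x → kron x c) (ℕ.m+n∸m≡n (2 *ℕ j) c)) (kron-refl c))) ⟩
  N * (M-coefficient m j * 1ℚ)
    ≡⟨ cong (N *_) (*-identityʳ (M-coefficient m j)) ⟩
  N * M-coefficient m j
    ≡⟨ scaledCatalan-closed-form j c ⟨
  ℕ→ℚ (scaledCatalan j c)
    ≡⟨ iterateSlice-on j c refl ⟨
  iterateSlice (suc m) (suc j) c ∎
  where
  open ≡-Reasoning
  N : ℚ
  N = ℕ→ℚ (suc (suc m) !)
... | no off = trans (cong (N *_) (Σ≤-zero (m /ℕ 2) λ k k≤ → vanish k k≤ (k ℕ.≟ j)))
                     (trans (*-zeroʳ N) (sym (iterateSlice-off j c off)))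
  where
  N : ℚ
  N = ℕ→ℚ (suc (suc m) !)
  vanish : ∀ k → k ≤ m /ℕ 2 → Dec (k ≡ j) → M-term m k (suc j) c ≡ 0ℚ
  vanish k k≤ (yes refl) = *-kron-≢ʳ (M-coefficient m k) (kron k k)
    λ e → off (trans (cong (2 *ℕ k +ℕ_) (sym e)) (ℕ.m+[n∸m]≡n (k≤m/2⇒2*k≤m k≤)))
  vanish k k≤ (no k≢j)   = *-kron-≢ˡ (M-coefficient m k) (kron (m ∸ 2 *ℕ k) c) k≢j

theorem1p22 : (n : ℕ) → 1 ≤ n →
    Dⁿ n (con ½ ⊗ v) ≈P (con (ℕ→ℚ (suc n !)) ⊗ pow t n ⊗ M (n ∸ 1))
theorem1p22 (suc m) _ = at (begin
  coeff (Dⁿ (suc m) (con ½ ⊗ v))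
    ≈⟨ coeff-Dⁿ-½v (suc m) ⟩
  t^ suc m · iterateSlice (suc m)
    ≈⟨ t^-cong (suc m) (λ b c → M-slice≡iterateSlice m b c) ⟨
  t^ suc m · (λ b c → ℕ→ℚ (suc (suc m) !) * M-slice m b c)
    ≈⟨ coeff-N⊗tⁿ⊗M m ⟨
  coeff (con (ℕ→ℚ (suc (suc m) !)) ⊗ pow t (suc m) ⊗ M m) ∎)
  where open ≐-Reasoning
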